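{- Let $L$ be a multiset of even integers greater than $2$. If $\epsilon\ge(2|L|+3)(\max(L)+3)$, then there is a graceful labeling $\Gamma$ of $\left[L,2\ \middle|\ \epsilon-\sum_{\ell\in L}\ell-2\right]$ such that $\Delta_p\Gamma\supseteq\mathcal{I}\big((2|L|+1)(\max(L)+3)+1,\,\epsilon\big)$.
   Context: $\mathcal{I}(a,b)=\{x\in\mathbb{Z}\mid a\le x\le b\}$; $|L|$ counts multiplicity; the maximum of an empty multiset is $0$. $[L,2\mid m]$ is the vertex-disjoint union of one $\ell$-cycle for each $\ell\in L$, one $2$-cycle (two vertices joined by two parallel edges), and a path with $m$ edges; its number of edges is $\epsilon=\sum_{\ell\in L}\ell+2+m$. A labeling is an isomorphic copy with distinct integer vertices; $\Delta\Gamma$ is the multiset of differences $x-y$ over ordered pairs of adjacent vertices (parallel edges counted separately), and $\Delta_p\Gamma$ is the same restricted to edges of the path. A graceful labeling of such a graph (with exactly one $2$-cycle) is a labeling $\Gamma$ with vertex set $\mathcal{I}(0,\epsilon)$ and $\Delta\Gamma=\pm\{1,3,3\}\cup\pm\mathcal{I}(4,\epsilon)$ as multisets. -}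

module Defs where

open import Data.Nat as ℕ using (ℕ; suc; _∸_; _⊔_)
open import Data.Integer as ℤ using (ℤ; +_; -_; _-_)
open import Data.List using (List; []; _∷_; _++_; [_]; map; upTo; concat; length; foldr)
open import Data.List.Relation.Binary.Pointwise using (Pointwise)
open import Data.List.Relation.Unary.Unique.Propositional using (Unique)
open import Data.List.Relation.Binary.Permutation.Propositional using (_↭_)
open import Data.Product using (Σ; _×_)
open import Relation.Binary.PropositionalEquality using (_≡_)

I : ℕ → ℕ → List ℤ
I a b = map (λ k → + (a ℕ.+ k)) (upTo (suc b ∸ a))

pm : List ℤ → List ℤ
pm xs = xs ++ map -_ xs

pathDiffs : List ℤ → List ℤ
pathDiffs (x ∷ y ∷ r) = (x - y) ∷ (y - x) ∷ pathDiffs (y ∷ r)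
pathDiffs _ = []

cycleDiffs : List ℤ → List ℤ
cycleDiffs [] = []
cycleDiffs (x ∷ r) = pathDiffs (x ∷ r ++ [ x ])

maxL : List ℕ → ℕ
maxL = foldr _⊔_ 0

sumL : List ℕ → ℕ
sumL = foldr ℕ._+_ 0

edges : List ℕ → ℕ → ℕ
edges L m = sumL L ℕ.+ 2 ℕ.+ m

-- a labeling of [L,2 | m]: an ℓ-cycle (cyclic vertex list of length ℓ) for each ℓ ∈ L,
-- a 2-cycle on vertices a b, and a path with m edges (m+1 vertices); all vertices distinct.
record Labeling (L : List ℕ) (m : ℕ) : Set where
  field
    cycles   : List (List ℤ)
    cycLen   : Pointwise (λ ℓ c → length c ≡ ℓ) L cycles
    twoA     : ℤ
    twoB     : ℤ
    path     : List ℤ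
    pathLen  : length path ≡ suc m
  vertices : List ℤ
  vertices = concat cycles ++ twoA ∷ twoB ∷ path
  field
    distinct : Unique vertices

  -- ΔΓ : all differences over ordered adjacent pairs, parallel edges counted separately
  Δ : List ℤ
  Δ = concat (map cycleDiffs cycles)
      ++ ((twoA - twoB) ∷ (twoB - twoA) ∷ (twoA - twoB) ∷ (twoB - twoA) ∷ [])
      ++ pathDiffs path

  Δp : List ℤ
  Δp = pathDiffs path

open Labeling public

-- graceful labeling of a graph with exactly one 2-cycle:
-- vertex set I(0,ε) and ΔΓ = ±{1,3,3} ∪ ±I(4,ε) as multisets
Graceful : {L : List ℕ} {m : ℕ} → Labeling L m → Set
Graceful {L} {m} Γ =
  (vertices Γ ↭ I 0 (edges L m)) ×
  (Δ Γ ↭ pm (+ 1 ∷ + 3 ∷ + 3 ∷ []) ++ pm (I 4 (edges L m)))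

_⊇ₘ_ : List ℤ → List ℤ → Set
A ⊇ₘ B = Σ (List ℤ) λ R → A ↭ B ++ R

module Submission where

-- Split the vertices into a low side lo 0, lo 1, … and a high side hi 0, hi 1, …, labelled
-- N - 1 - r and N + c where N is the number of low vertices.  An edge lo r — hi c then has
-- difference ±(r + c + 1), so it suffices to lay the graph out as zigzags lo–hi–lo–… whose
-- edge weights r + c are 0, 2, 2 and each of 3, …, ε - 1 exactly once, using every vertex once.
-- The 2-cycle is lo 1 — hi 1 (weight 2 twice) and the path starts lo 0 — hi 0 — lo 3.
-- An ℓ-cycle, ℓ = 4m + 4 or 4m + 6, is built from two ladders of slope 3; together with a
-- third ladder on the path it fills the sides [X, X + s), s = 3m + 4, and realises exactly
-- the weights [2X, 2X + 2s).  The blocks are stacked from X = 2, and the path ends with a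
-- tail made of 4-edge squares and one of four small end pieces, which realises any number
-- n ≥ 5 of consecutive weights.  These largest differences all lie on the path.

open import Defs
open import Data.Nat using (ℕ; _+_; _*_; _∸_; _<_; _≤_)
open import Data.Nat.Divisibility using (_∣_)
open import Data.List using (List; length)
open import Data.List.Relation.Unary.All using (All)
open import Data.Product using (Σ; _×_)

import Algebra.Solver.CommutativeMonoid as CommutativeMonoidSolver
open import Data.List as List using ([]; _∷_; _++_; [_]; map; concat; concatMap; fromMaybe)
import Data.List.Properties as ListP
open import Data.List.Relation.Binary.Permutation.Propositional
  using (_↭_; prep; swap; ↭-refl; ↭-reflexive; ↭-sym; ↭-trans; ↭⇒↭ₛ; module PermutationReasoning)
open import Data.List.Relation.Binary.Permutation.Propositional.Properties
  using (++-commutativeMonoid; ++⁺; ++⁺ˡ; ++⁺ʳ; shift; shifts; map⁺; ↭-length; ++-comm; ∷↭∷ʳ)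
import Data.List.Relation.Binary.Permutation.Setoid.Properties as SetoidPermutation
open import Data.List.Relation.Binary.Pointwise using (Pointwise; []; _∷_)
open import Data.List.Relation.Unary.All as All using ([]; _∷_)
open import Data.List.Relation.Unary.Unique.Propositional using (Unique)
import Data.List.Relation.Unary.Unique.Propositional.Properties as UniqueP
open import Data.Maybe as Maybe using (Maybe; just; nothing)
open import Data.Nat as ℕ using (zero; suc)
open import Data.Nat.Divisibility using (divides)
import Data.Nat.Properties as ℕP
open import Data.Nat.Tactic.RingSolver using (solve-∀)
open import Data.List.Sort.Base ℕP.≤-totalOrder using (module SortingAlgorithm)
open import Data.List.Sort.MergeSort ℕP.≤-decTotalOrder using (mergeSort)
open import Data.Product as Product using (_,_)
open import Data.Sum using (_⊎_; inj₁; inj₂)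
open import Relation.Binary.PropositionalEquality
  using (_≡_; refl; sym; trans; cong; cong₂; subst; setoid; module ≡-Reasoning)

-- Intervals and arithmetic progressions

range : ℕ → ℕ → List ℕ
range a zero    = []
range a (suc n) = a ∷ range (suc a) n

range-++ : ∀ a m n → range a m ++ range (a + m) n ≡ range a (m + n)
range-++ a zero    n = cong (λ b → range b n) (ℕP.+-identityʳ a)
range-++ a (suc m) n =
  cong (a ∷_) (trans (cong (λ b → range (suc a) m ++ range b n) (ℕP.+-suc a m)) (range-++ (suc a) m n))

map-+-range : ∀ d a n → map (d +_) (range a n) ≡ range (d + a) n
map-+-range d a zero    = refl
map-+-range d a (suc n) =
  cong (d + a ∷_) (trans (map-+-range d (suc a) n) (cong (λ b → range b n) (ℕP.+-suc d a)))

length-range : ∀ a n → length (range a n) ≡ n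
length-range a zero    = refl
length-range a (suc n) = cong suc (length-range (suc a) n)

map-+-range₀ : ∀ d n → map (d +_) (range 0 n) ≡ range d n
map-+-range₀ d n = trans (map-+-range d 0 n) (cong (λ a → range a n) (ℕP.+-identityʳ d))

progression : ℕ → ℕ → ℕ → List ℕ
progression d a zero    = []
progression d a (suc n) = a ∷ progression d (d + a) n

progression-snoc : ∀ d a n → progression d a (suc n) ≡ progression d a n ++ [ a + n * d ]
progression-snoc d a zero    = cong (λ x → [ x ]) (sym (ℕP.+-identityʳ a))
progression-snoc d a (suc n) =
  cong (a ∷_) (trans (progression-snoc d (d + a) n) (cong (λ x → progression d (d + a) n ++ [ x ]) (reassoc d a n)))
  where
  reassoc : ∀ d a n → d + a + n * d ≡ a + (d + n * d)
  reassoc = solve-∀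

interleave-progressions : ∀ d m b → concatMap (λ a → progression d a m) (range b d) ↭ range b (m * d)
interleave-progressions d zero    b = ↭-reflexive (nil (range b d))
  where
  nil : (as : List ℕ) → concatMap (λ _ → []) as ≡ []
  nil []       = refl
  nil (_ ∷ as) = nil as
interleave-progressions d (suc m) b = begin
  concatMap (λ a → a ∷ progression d (d + a) m) (range b d) ↭⟨ heads (range b d) ⟩
  range b d ++ concatMap (λ a → progression d (d + a) m) (range b d)
    ≡⟨ cong (λ as → range b d ++ concat as) (ListP.map-∘ (range b d)) ⟩
  range b d ++ concatMap (λ a → progression d a m) (map (d +_) (range b d))
    ≡⟨ cong (λ as → range b d ++ concatMap (λ a → progression d a m) as) (map-+-range d b d) ⟩
  range b d ++ concatMap (λ a → progression d a m) (range (d + b) d)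
    ↭⟨ ++⁺ˡ (range b d) (interleave-progressions d m (d + b)) ⟩
  range b d ++ range (d + b) (m * d)
    ≡⟨ cong (λ a → range b d ++ range a (m * d)) (ℕP.+-comm d b) ⟩
  range b d ++ range (b + d) (m * d) ≡⟨ range-++ b d (m * d) ⟩
  range b (d + m * d) ∎
  where
  open PermutationReasoning
  heads : ∀ as → concatMap (λ a → a ∷ progression d (d + a) m) as ↭
                 as ++ concatMap (λ a → progression d (d + a) m) as
  heads []       = ↭-refl
  heads (a ∷ as) = prep a (↭-trans (++⁺ˡ (progression d (d + a) m) (heads as)) (shifts (progression d (d + a) m) as))

range-suffix : ∀ a n c → a ≤ c → c ≤ a + n → Σ (List ℕ) λ R → range a n ↭ range c (a + n ∸ c) ++ R
range-suffix a n c a≤c c≤a+n = range a (c ∸ a) , (begin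
  range a n                                          ≡⟨ cong (range a) split ⟩
  range a ((c ∸ a) + (a + n ∸ c))                    ≡⟨ sym (range-++ a (c ∸ a) _) ⟩
  range a (c ∸ a) ++ range (a + (c ∸ a)) (a + n ∸ c) ≡⟨ cong (λ b → range a (c ∸ a) ++ range b (a + n ∸ c)) (ℕP.m+[n∸m]≡n a≤c) ⟩
  range a (c ∸ a) ++ range c (a + n ∸ c)             ↭⟨ ++-comm (range a (c ∸ a)) _ ⟩
  range c (a + n ∸ c) ++ range a (c ∸ a) ∎)
  where
  open PermutationReasoning
  split : n ≡ (c ∸ a) + (a + n ∸ c)
  split = ℕP.+-cancelˡ-≡ a n _ (trans (sym (ℕP.m+[n∸m]≡n c≤a+n))
    (trans (cong (_+ (a + n ∸ c)) (sym (ℕP.m+[n∸m]≡n a≤c))) (ℕP.+-assoc a (c ∸ a) _)))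

suffix-after-3 : ∀ A n c → A ≤ c ⊎ (A ≡ 4 × c ≡ 3) → c ≤ A + n →
  Σ (List ℕ) λ R → 3 ∷ range A n ↭ range c (A + n ∸ c) ++ R
suffix-after-3 A n c (inj₁ A≤c) c≤A+n with range-suffix A n c A≤c c≤A+n
... | R , split = 3 ∷ R , ↭-trans (prep 3 split) (↭-sym (shift 3 (range c (A + n ∸ c)) R))
suffix-after-3 .4 n .3 (inj₂ (refl , refl)) _ = [] , ↭-sym (↭-reflexive (ListP.++-identityʳ (range 3 (suc n))))

++-interchange : ∀ {A : Set} (a b c d : List A) → (a ++ b) ++ (c ++ d) ↭ (a ++ c) ++ (b ++ d)
++-interchange a b c d = begin
  (a ++ b) ++ (c ++ d) ≡⟨ ListP.++-assoc a b (c ++ d) ⟩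
  a ++ b ++ c ++ d     ↭⟨ ++⁺ˡ a (shifts b c) ⟩
  a ++ c ++ b ++ d     ≡⟨ sym (ListP.++-assoc a c (b ++ d)) ⟩
  (a ++ c) ++ (b ++ d) ∎
  where open PermutationReasoning

open SortingAlgorithm mergeSort using (sort; sort-↭)
module NS = CommutativeMonoidSolver (++-commutativeMonoid {A = ℕ})

↭-by-sorting : ∀ {xs ys : List ℕ} → sort xs ≡ sort ys → xs ↭ ys
↭-by-sorting {xs} {ys} eq = ↭-trans (↭-sym (sort-↭ xs)) (↭-trans (↭-reflexive eq) (sort-↭ ys))

-- Zigzag walks

data Vertex : Set where
  lo hi : ℕ → Vertex

module VS = CommutativeMonoidSolver (++-commutativeMonoid {A = Vertex})

Zigzag : Set
Zigzag = List (ℕ × ℕ)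

walk : Zigzag → Maybe ℕ → List Vertex
walk []            e = map lo (fromMaybe e)
walk ((r , c) ∷ z) e = lo r ∷ hi c ∷ walk z e

closed : Zigzag → List Vertex
closed z = walk z nothing

nextLo : Zigzag → Maybe ℕ → Maybe ℕ
nextLo []            e = e
nextLo ((r , _) ∷ _) _ = just r

-- The weight of an edge lo r — hi c is r + c; nextLo z e is the low vertex following z.
weights : Zigzag → Maybe ℕ → List ℕ
weights []            e = []
weights ((r , c) ∷ z) e = r + c ∷ map (c +_) (fromMaybe (nextLo z e)) ++ weights z e

cycleWeights : Zigzag → List ℕ
cycleWeights z = weights z (nextLo z nothing)

walk-++ : ∀ z z′ e → walk (z ++ z′) e ≡ closed z ++ walk z′ e
walk-++ []            z′ e = refl
walk-++ ((r , c) ∷ z) z′ e = cong (λ vs → lo r ∷ hi c ∷ vs) (walk-++ z z′ e)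

closed-++-end : ∀ z e → closed z ++ map lo (fromMaybe e) ≡ walk z e
closed-++-end z e = trans (sym (walk-++ z [] e)) (cong (λ z → walk z e) (ListP.++-identityʳ z))

nextLo-++ : ∀ z z′ e → nextLo (z ++ z′) e ≡ nextLo z (nextLo z′ e)
nextLo-++ []      z′ e = refl
nextLo-++ (_ ∷ _) z′ e = refl

weights-++ : ∀ z z′ e → weights (z ++ z′) e ≡ weights z (nextLo z′ e) ++ weights z′ e
weights-++ []            z′ e = refl
weights-++ ((r , c) ∷ z) z′ e = cong (r + c ∷_) (begin
  map (c +_) (fromMaybe (nextLo (z ++ z′) e)) ++ weights (z ++ z′) e
    ≡⟨ cong₂ (λ x ws → map (c +_) (fromMaybe x) ++ ws) (nextLo-++ z z′ e) (weights-++ z z′ e) ⟩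
  map (c +_) (fromMaybe (nextLo z (nextLo z′ e))) ++ weights z (nextLo z′ e) ++ weights z′ e
    ≡⟨ sym (ListP.++-assoc (map (c +_) (fromMaybe (nextLo z (nextLo z′ e)))) _ _) ⟩
  (map (c +_) (fromMaybe (nextLo z (nextLo z′ e))) ++ weights z (nextLo z′ e)) ++ weights z′ e ∎)
  where open ≡-Reasoning

length-closed : ∀ z → length (closed z) ≡ length z + length z
length-closed []      = refl
length-closed (_ ∷ z) = cong suc (trans (cong suc (length-closed z)) (sym (ℕP.+-suc (length z) (length z))))

lows highs : List Vertex → List ℕ
lows []           = []
lows (lo r ∷ vs)  = r ∷ lows vs
lows (hi _ ∷ vs)  = lows vs
highs []          = []
highs (lo _ ∷ vs) = highs vs
highs (hi c ∷ vs) = c ∷ highs vs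

lows-++ : ∀ vs ws → lows (vs ++ ws) ≡ lows vs ++ lows ws
lows-++ []          ws = refl
lows-++ (lo r ∷ vs) ws = cong (r ∷_) (lows-++ vs ws)
lows-++ (hi _ ∷ vs) ws = lows-++ vs ws

highs-++ : ∀ vs ws → highs (vs ++ ws) ≡ highs vs ++ highs ws
highs-++ []          ws = refl
highs-++ (lo _ ∷ vs) ws = highs-++ vs ws
highs-++ (hi c ∷ vs) ws = cong (c ∷_) (highs-++ vs ws)

lows-closed-++ : ∀ z z′ → lows (closed (z ++ z′)) ≡ lows (closed z) ++ lows (closed z′)
lows-closed-++ z z′ = trans (cong lows (walk-++ z z′ nothing)) (lows-++ (closed z) (closed z′))

highs-closed-++ : ∀ z z′ → highs (closed (z ++ z′)) ≡ highs (closed z) ++ highs (closed z′)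
highs-closed-++ z z′ = trans (cong highs (walk-++ z z′ nothing)) (highs-++ (closed z) (closed z′))

↭-lows-highs : ∀ vs → vs ↭ map lo (lows vs) ++ map hi (highs vs)
↭-lows-highs []          = ↭-refl
↭-lows-highs (lo r ∷ vs) = prep (lo r) (↭-lows-highs vs)
↭-lows-highs (hi c ∷ vs) = ↭-trans (prep (hi c) (↭-lows-highs vs)) (↭-sym (shift (hi c) (map lo (lows vs)) _))

span : ℕ → ℕ → ℕ → List Vertex
span X a b = map lo (range X a) ++ map hi (range X b)

span-by-sides : ∀ {vs} X a b → lows vs ↭ range X a → highs vs ↭ range X b → vs ↭ span X a b
span-by-sides {vs} _ _ _ l h = ↭-trans (↭-lows-highs vs) (++⁺ (map⁺ lo l) (map⁺ hi h))

span-++ : ∀ X e a b → span X e e ++ span (X + e) a b ↭ span X (e + a) (e + b)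
span-++ X e a b = begin
  (L e ++ H e) ++ (L′ a ++ H′ b)  ↭⟨ ++-interchange (L e) (H e) (L′ a) (H′ b) ⟩
  (L e ++ L′ a) ++ (H e ++ H′ b)  ≡⟨ cong₂ _++_ (joined lo a) (joined hi b) ⟩
  span X (e + a) (e + b) ∎
  where
  open PermutationReasoning
  L H L′ H′ : ℕ → List Vertex
  L n = map lo (range X n)
  H n = map hi (range X n)
  L′ n = map lo (range (X + e) n)
  H′ n = map hi (range (X + e) n)
  joined : ∀ (v : ℕ → Vertex) n → map v (range X e) ++ map v (range (X + e) n) ≡ map v (range X (e + n))
  joined v n = trans (sym (ListP.map-++ v (range X e) _)) (cong (map v) (range-++ X e n))

translate : ℕ → Zigzag → Zigzag
translate d = map (Product.map (d +_) (d +_))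

translateᵛ : ℕ → Vertex → Vertex
translateᵛ d (lo r) = lo (d + r)
translateᵛ d (hi c) = hi (d + c)

walk-translate : ∀ d z e → walk (translate d z) (Maybe.map (d +_) e) ≡ map (translateᵛ d) (walk z e)
walk-translate d []            nothing  = refl
walk-translate d []            (just x) = refl
walk-translate d ((r , c) ∷ z) e        = cong (λ vs → lo (d + r) ∷ hi (d + c) ∷ vs) (walk-translate d z e)

nextLo-translate : ∀ d z e → nextLo (translate d z) (Maybe.map (d +_) e) ≡ Maybe.map (d +_) (nextLo z e)
nextLo-translate d []      e = refl
nextLo-translate d (_ ∷ _) e = refl

+-interchange : ∀ d a b → (d + a) + (d + b) ≡ (d + d) + (a + b)
+-interchange = solve-∀

weights-translate : ∀ d z e → weights (translate d z) (Maybe.map (d +_) e) ≡ map (d + d +_) (weights z e)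
weights-translate d []            e = refl
weights-translate d ((r , c) ∷ z) e = cong₂ _∷_ (+-interchange d r c) (begin
  map (d + c +_) (fromMaybe (nextLo (translate d z) (Maybe.map (d +_) e))) ++ weights (translate d z) (Maybe.map (d +_) e)
    ≡⟨ cong₂ (λ x ws → map (d + c +_) (fromMaybe x) ++ ws) (nextLo-translate d z e) (weights-translate d z e) ⟩
  map (d + c +_) (fromMaybe (Maybe.map (d +_) (nextLo z e))) ++ map (d + d +_) (weights z e)
    ≡⟨ cong (_++ map (d + d +_) (weights z e)) (closing (nextLo z e)) ⟩
  map (d + d +_) (map (c +_) (fromMaybe (nextLo z e))) ++ map (d + d +_) (weights z e)
    ≡⟨ sym (ListP.map-++ (d + d +_) (map (c +_) (fromMaybe (nextLo z e))) _) ⟩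
  map (d + d +_) (map (c +_) (fromMaybe (nextLo z e)) ++ weights z e) ∎)
  where
  open ≡-Reasoning
  closing : ∀ x → map (d + c +_) (fromMaybe (Maybe.map (d +_) x)) ≡ map (d + d +_) (map (c +_) (fromMaybe x))
  closing nothing  = refl
  closing (just x) = cong [_] (+-interchange d c x)

cycleWeights-translate : ∀ d z → cycleWeights (translate d z) ≡ map (d + d +_) (cycleWeights z)
cycleWeights-translate d z =
  trans (cong (weights (translate d z)) (nextLo-translate d z nothing)) (weights-translate d z (nextLo z nothing))

span-translate : ∀ d a b → map (translateᵛ d) (span 0 a b) ≡ span d a b
span-translate d a b = begin
  map (translateᵛ d) (map lo (range 0 a) ++ map hi (range 0 b))
    ≡⟨ ListP.map-++ (translateᵛ d) (map lo (range 0 a)) _ ⟩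
  map (translateᵛ d) (map lo (range 0 a)) ++ map (translateᵛ d) (map hi (range 0 b))
    ≡⟨ cong₂ _++_ (sym (ListP.map-∘ (range 0 a))) (sym (ListP.map-∘ (range 0 b))) ⟩
  map (λ r → lo (d + r)) (range 0 a) ++ map (λ c → hi (d + c)) (range 0 b)
    ≡⟨ cong₂ _++_ (ListP.map-∘ (range 0 a)) (ListP.map-∘ (range 0 b)) ⟩
  map lo (map (d +_) (range 0 a)) ++ map hi (map (d +_) (range 0 b))
    ≡⟨ cong₂ (λ as bs → map lo as ++ map hi bs) (map-+-range₀ d a) (map-+-range₀ d b) ⟩
  span d a b ∎
  where open ≡-Reasoning

-- Integer labels

open import Data.Integer as ℤ using (ℤ; -[1+_]; +[1+_])
import Data.Integer.Properties as ℤP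
import Data.Integer.Tactic.RingSolver as ℤSolver

label : ℕ → Vertex → ℤ
label n (lo r) = ℤ.+ n ℤ.- +[1+ r ]
label n (hi c) = ℤ.+ (n + c)

hi-lo-difference : ∀ n r c → label n (hi c) ℤ.- label n (lo r) ≡ +[1+ r + c ]
hi-lo-difference n r c = begin
  ℤ.+ (n + c) ℤ.- (ℤ.+ n ℤ.- +[1+ r ])
    ≡⟨ cong₂ (λ x y → x ℤ.- (ℤ.+ n ℤ.- y)) (ℤP.pos-+ n c) (ℤP.pos-+ 1 r) ⟩
  (ℤ.+ n ℤ.+ ℤ.+ c) ℤ.- (ℤ.+ n ℤ.- (ℤ.+ 1 ℤ.+ ℤ.+ r)) ≡⟨ rearrange (ℤ.+ n) (ℤ.+ r) (ℤ.+ c) ⟩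
  ℤ.+ 1 ℤ.+ (ℤ.+ r ℤ.+ ℤ.+ c)                         ≡⟨ cong (λ x → ℤ.+ 1 ℤ.+ x) (sym (ℤP.pos-+ r c)) ⟩
  +[1+ r + c ] ∎
  where
  open ≡-Reasoning
  rearrange : ∀ (n r c : ℤ) → (n ℤ.+ c) ℤ.- (n ℤ.- (ℤ.+ 1 ℤ.+ r)) ≡ ℤ.+ 1 ℤ.+ (r ℤ.+ c)
  rearrange = ℤSolver.solve-∀

lo-hi-difference : ∀ n r c → label n (lo r) ℤ.- label n (hi c) ≡ -[1+ r + c ]
lo-hi-difference n r c =
  trans (antisymmetric (label n (lo r)) (label n (hi c))) (cong ℤ.-_ (hi-lo-difference n r c))
  where
  antisymmetric : ∀ (x y : ℤ) → x ℤ.- y ≡ ℤ.- (y ℤ.- x)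
  antisymmetric = ℤSolver.solve-∀

ints : List ℕ → List ℤ
ints = map (λ n → ℤ.+ n)

±suc : List ℕ → List ℤ
±suc []       = []
±suc (w ∷ ws) = +[1+ w ] ∷ -[1+ w ] ∷ ±suc ws

±suc-++ : ∀ ws vs → ±suc (ws ++ vs) ≡ ±suc ws ++ ±suc vs
±suc-++ []       vs = refl
±suc-++ (w ∷ ws) vs = cong (λ xs → +[1+ w ] ∷ -[1+ w ] ∷ xs) (±suc-++ ws vs)

±suc⁺ : ∀ {ws vs} → ws ↭ vs → ±suc ws ↭ ±suc vs
±suc⁺ _↭_.refl            = ↭-refl
±suc⁺ (prep w p)          = prep _ (prep _ (±suc⁺ p))
±suc⁺ (_↭_.swap w v p)    =
  ↭-trans (shifts (+[1+ w ] ∷ -[1+ w ] ∷ []) (+[1+ v ] ∷ -[1+ v ] ∷ [])) (prep _ (prep _ (prep _ (prep _ (±suc⁺ p)))))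
±suc⁺ (_↭_.trans p q)     = ↭-trans (±suc⁺ p) (±suc⁺ q)

±suc-↭-pm : ∀ ws → ±suc ws ↭ pm (ints (map suc ws))
±suc-↭-pm []       = ↭-refl
±suc-↭-pm (w ∷ ws) =
  prep _ (↭-trans (prep _ (±suc-↭-pm ws)) (↭-sym (shift -[1+ w ] (ints (map suc ws)) _)))

pm-++ : ∀ xs ys → pm (xs ++ ys) ↭ pm xs ++ pm ys
pm-++ xs ys = begin
  (xs ++ ys) ++ map ℤ.-_ (xs ++ ys)           ≡⟨ cong ((xs ++ ys) ++_) (ListP.map-++ ℤ.-_ xs ys) ⟩
  (xs ++ ys) ++ (map ℤ.-_ xs ++ map ℤ.-_ ys)  ↭⟨ ++-interchange xs ys (map ℤ.-_ xs) (map ℤ.-_ ys) ⟩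
  pm xs ++ pm ys ∎
  where open PermutationReasoning

∷∷⁺ : ∀ {x x′ y y′ : ℤ} {xs ys} → x ≡ x′ → y ≡ y′ → xs ↭ ys → x ∷ y ∷ xs ↭ x′ ∷ y′ ∷ ys
∷∷⁺ refl refl p = prep _ (prep _ p)

walk-differences : ∀ n z e → pathDiffs (map (label n) (walk z e)) ↭ ±suc (weights z e)
differences-from-hi : ∀ n c z e →
  pathDiffs (label n (hi c) ∷ map (label n) (walk z e)) ↭ ±suc (map (c +_) (fromMaybe (nextLo z e)) ++ weights z e)

walk-differences n []            nothing  = ↭-refl
walk-differences n []            (just x) = ↭-refl
walk-differences n ((r , c) ∷ z) e        =
  ↭-trans (swap _ _ ↭-refl) (∷∷⁺ (hi-lo-difference n r c) (lo-hi-difference n r c) (differences-from-hi n c z e))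

differences-from-hi n c []             nothing  = ↭-refl
differences-from-hi n c []             (just x) =
  ∷∷⁺ (trans (hi-lo-difference n x c) (cong +[1+_] (ℕP.+-comm x c)))
      (trans (lo-hi-difference n x c) (cong -[1+_] (ℕP.+-comm x c))) ↭-refl
differences-from-hi n c ((r , c′) ∷ z) e        =
  ∷∷⁺ (trans (hi-lo-difference n r c) (cong +[1+_] (ℕP.+-comm r c)))
      (trans (lo-hi-difference n r c) (cong -[1+_] (ℕP.+-comm r c))) (walk-differences n ((r , c′) ∷ z) e)

cycle-differences : ∀ n z → cycleDiffs (map (label n) (closed z)) ↭ ±suc (cycleWeights z)
cycle-differences n []            = ↭-refl
cycle-differences n ((r , c) ∷ z) = ↭-trans (↭-reflexive (cong (λ vs → pathDiffs (label n (lo r) ∷ label n (hi c) ∷ vs)) closing))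
                                            (walk-differences n ((r , c) ∷ z) (just r))
  where
  closing : map (label n) (closed z) ++ [ label n (lo r) ] ≡ map (label n) (walk z (just r))
  closing = trans (sym (ListP.map-++ (label n) (closed z) _)) (cong (map (label n)) (closed-++-end z (just r)))

cycles-differences : ∀ N (cs : List Zigzag) →
  concatMap cycleDiffs (map (λ c → map (label N) (closed c)) cs) ↭ ±suc (concatMap cycleWeights cs)
cycles-differences N []       = ↭-refl
cycles-differences N (c ∷ cs) =
  ↭-trans (++⁺ (cycle-differences N c) (cycles-differences N cs)) (↭-reflexive (sym (±suc-++ (cycleWeights c) _)))

I≡ints-range : ∀ a b → I a b ≡ ints (range a (suc b ∸ a))
I≡ints-range a b = begin
  map (λ k → ℤ.+ (a + k)) (List.upTo (suc b ∸ a))   ≡⟨ ListP.map-∘ (List.upTo (suc b ∸ a)) ⟩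
  ints (map (a +_) (List.upTo (suc b ∸ a)))          ≡⟨ cong (λ ns → ints (map (a +_) ns)) (upTo≡range (suc b ∸ a)) ⟩
  ints (map (a +_) (range 0 (suc b ∸ a)))            ≡⟨ cong ints (map-+-range₀ a (suc b ∸ a)) ⟩
  ints (range a (suc b ∸ a)) ∎
  where
  open ≡-Reasoning
  applyUpTo≡range : ∀ f a n → (∀ k → f k ≡ a + k) → List.applyUpTo f n ≡ range a n
  applyUpTo≡range f a zero    f≗ = refl
  applyUpTo≡range f a (suc n) f≗ = cong₂ _∷_ (trans (f≗ 0) (ℕP.+-identityʳ a))
    (applyUpTo≡range (λ k → f (suc k)) (suc a) n (λ k → trans (f≗ (suc k)) (ℕP.+-suc a k)))
  upTo≡range : ∀ n → List.upTo n ≡ range 0 n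
  upTo≡range n = applyUpTo≡range (λ k → k) 0 n (λ k → refl)

lo-labels : ∀ k N → map (λ r → label (k + N) (lo r)) (range 0 N) ↭ ints (range k N)
lo-labels k zero    = ↭-refl
lo-labels k (suc N) = begin
  ℤ.+ (k + suc N) ℤ.- +[1+ 0 ] ∷ map (λ r → label (k + suc N) (lo r)) (range 1 N)
    ≡⟨ cong₂ _∷_ top (trans (cong (map _) (sym (map-+-range 1 0 N))) (sym (ListP.map-∘ (range 0 N)))) ⟩
  ℤ.+ (k + N) ∷ map (λ r → label (k + suc N) (lo (suc r))) (range 0 N)
    ≡⟨ cong (ℤ.+ (k + N) ∷_) (ListP.map-cong step (range 0 N)) ⟩
  ℤ.+ (k + N) ∷ map (λ r → label (k + N) (lo r)) (range 0 N)
    ↭⟨ prep _ (lo-labels k N) ⟩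
  ℤ.+ (k + N) ∷ ints (range k N)    ↭⟨ ∷↭∷ʳ _ _ ⟩
  ints (range k N) ++ ints [ k + N ] ≡⟨ trans (sym (ListP.map-++ _ (range k N) _)) (cong ints (range-++ k N 1)) ⟩
  ints (range k (N + 1))             ≡⟨ cong (λ n → ints (range k n)) (ℕP.+-comm N 1) ⟩
  ints (range k (suc N)) ∎
  where
  open PermutationReasoning
  cancel : ∀ (a b : ℤ) → (ℤ.+ 1 ℤ.+ a) ℤ.- (ℤ.+ 1 ℤ.+ b) ≡ a ℤ.- b
  cancel = ℤSolver.solve-∀
  top : ℤ.+ (k + suc N) ℤ.- +[1+ 0 ] ≡ ℤ.+ (k + N)
  top = trans (cong (λ x → ℤ.+ x ℤ.- +[1+ 0 ]) (ℕP.+-suc k N))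
              (trans (cong (λ x → x ℤ.- +[1+ 0 ]) (ℤP.pos-+ 1 (k + N))) (trans (cancel (ℤ.+ (k + N)) (ℤ.+ 0)) (ℤP.+-identityʳ _)))
  step : ∀ r → label (k + suc N) (lo (suc r)) ≡ label (k + N) (lo r)
  step r = trans (cong₂ (λ x y → x ℤ.- y) (trans (cong (λ x → ℤ.+ x) (ℕP.+-suc k N)) (ℤP.pos-+ 1 (k + N))) (ℤP.pos-+ 1 (suc r)))
                 (cancel (ℤ.+ (k + N)) +[1+ r ])

labels-span : ∀ N M → map (label N) (span 0 N M) ↭ ints (range 0 (N + M))
labels-span N M = begin
  map (label N) (map lo (range 0 N) ++ map hi (range 0 M))
    ≡⟨ ListP.map-++ (label N) (map lo (range 0 N)) _ ⟩
  map (label N) (map lo (range 0 N)) ++ map (label N) (map hi (range 0 M))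
    ≡⟨ cong₂ _++_ (sym (ListP.map-∘ (range 0 N))) (sym (ListP.map-∘ (range 0 M))) ⟩
  map (λ r → label N (lo r)) (range 0 N) ++ map (λ c → ℤ.+ (N + c)) (range 0 M)
    ↭⟨ ++⁺ʳ _ (lo-labels 0 N) ⟩
  ints (range 0 N) ++ map (λ c → ℤ.+ (N + c)) (range 0 M)
    ≡⟨ cong (ints (range 0 N) ++_) highs-shifted ⟩
  ints (range 0 N) ++ ints (range N M)
    ≡⟨ trans (sym (ListP.map-++ _ (range 0 N) _)) (cong ints (range-++ 0 N M)) ⟩
  ints (range 0 (N + M)) ∎
  where
  open PermutationReasoning
  highs-shifted : map (λ c → ℤ.+ (N + c)) (range 0 M) ≡ ints (range N M)
  highs-shifted = trans (ListP.map-∘ (range 0 M)) (cong ints (map-+-range₀ N M))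

Unique-resp-↭ : ∀ {xs ys : List ℤ} → xs ↭ ys → Unique xs → Unique ys
Unique-resp-↭ p = SetoidPermutation.Unique-resp-↭ (setoid ℤ) (↭⇒↭ₛ p)

Unique-I : ∀ a b → Unique (I a b)
Unique-I a b = UniqueP.map⁺ (λ eq → ℕP.+-cancelˡ-≡ a _ _ (ℤP.+-injective eq)) (UniqueP.upTo⁺ (suc b ∸ a))

-- Blocks

ascending : ℕ → ℕ → ℕ → Zigzag
ascending r c zero    = []
ascending r c (suc n) = (r , c) ∷ ascending (3 + r) (3 + c) n

descending : ℕ → ℕ → ℕ → Zigzag
descending r c zero    = []
descending r c (suc n) = descending (3 + r) (3 + c) n ++ (r , c) ∷ []

lows-ascending : ∀ r c n → lows (closed (ascending r c n)) ≡ progression 3 r n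
lows-ascending r c zero    = refl
lows-ascending r c (suc n) = cong (r ∷_) (lows-ascending (3 + r) (3 + c) n)

highs-ascending : ∀ r c n → highs (closed (ascending r c n)) ≡ progression 3 c n
highs-ascending r c zero    = refl
highs-ascending r c (suc n) = cong (c ∷_) (highs-ascending (3 + r) (3 + c) n)

lows-descending : ∀ r c n → lows (closed (descending r c n)) ↭ progression 3 r n
lows-descending r c zero    = ↭-refl
lows-descending r c (suc n) = begin
  lows (closed (descending (3 + r) (3 + c) n ++ (r , c) ∷ []))
    ≡⟨ trans (cong lows (walk-++ (descending (3 + r) (3 + c) n) _ nothing)) (lows-++ (closed (descending (3 + r) (3 + c) n)) _) ⟩
  lows (closed (descending (3 + r) (3 + c) n)) ++ [ r ] ↭⟨ ++⁺ʳ [ r ] (lows-descending (3 + r) (3 + c) n) ⟩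
  progression 3 (3 + r) n ++ [ r ]                      ↭⟨ ↭-sym (∷↭∷ʳ r _) ⟩
  progression 3 r (suc n) ∎
  where open PermutationReasoning

highs-descending : ∀ r c n → highs (closed (descending r c n)) ↭ progression 3 c n
highs-descending r c zero    = ↭-refl
highs-descending r c (suc n) = begin
  highs (closed (descending (3 + r) (3 + c) n ++ (r , c) ∷ []))
    ≡⟨ trans (cong highs (walk-++ (descending (3 + r) (3 + c) n) _ nothing)) (highs-++ (closed (descending (3 + r) (3 + c) n)) _) ⟩
  highs (closed (descending (3 + r) (3 + c) n)) ++ [ c ] ↭⟨ ++⁺ʳ [ c ] (highs-descending (3 + r) (3 + c) n) ⟩
  progression 3 (3 + c) n ++ [ c ]                       ↭⟨ ↭-sym (∷↭∷ʳ c _) ⟩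
  progression 3 c (suc n) ∎
  where open PermutationReasoning

weights-ascending-to : ∀ r c n x → weights (ascending r c (suc n)) (just x) ↭
  progression 6 (r + c) (suc n) ++ progression 6 (c + (3 + r)) n ++ [ c + n * 3 + x ]
weights-ascending-to r c zero    x = ↭-reflexive (cong (λ l → r + c ∷ [ l ]) (cong (_+ x) (sym (ℕP.+-identityʳ c))))
weights-ascending-to r c (suc n) x = begin
  r + c ∷ c + (3 + r) ∷ weights (ascending (3 + r) (3 + c) (suc n)) (just x)
    ↭⟨ prep _ (prep _ (weights-ascending-to (3 + r) (3 + c) n x)) ⟩
  r + c ∷ c + (3 + r) ∷ progression 6 ((3 + r) + (3 + c)) (suc n) ++ progression 6 ((3 + c) + (3 + (3 + r))) n ++ [ 3 + c + n * 3 + x ]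
    ≡⟨ cong₂ (λ a b → r + c ∷ c + (3 + r) ∷ progression 6 a (suc n) ++ progression 6 b n ++ [ 3 + c + n * 3 + x ])
             (rung-sum r c) (cross-sum r c) ⟩
  r + c ∷ c + (3 + r) ∷ progression 6 (6 + (r + c)) (suc n) ++ progression 6 (6 + (c + (3 + r))) n ++ [ 3 + c + n * 3 + x ]
    ≡⟨ cong (λ l → r + c ∷ c + (3 + r) ∷ progression 6 (6 + (r + c)) (suc n) ++ progression 6 (6 + (c + (3 + r))) n ++ [ l + x ])
            (last-high n c) ⟩
  r + c ∷ c + (3 + r) ∷ progression 6 (6 + (r + c)) (suc n) ++ progression 6 (6 + (c + (3 + r))) n ++ [ c + suc n * 3 + x ]
    ↭⟨ prep _ (↭-sym (shift (c + (3 + r)) (progression 6 (6 + (r + c)) (suc n)) _)) ⟩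
  progression 6 (r + c) (suc (suc n)) ++ progression 6 (c + (3 + r)) (suc n) ++ [ c + suc n * 3 + x ] ∎
  where
  open PermutationReasoning
  rung-sum : ∀ r c → (3 + r) + (3 + c) ≡ 6 + (r + c)
  rung-sum = solve-∀
  cross-sum : ∀ r c → (3 + c) + (3 + (3 + r)) ≡ 6 + (c + (3 + r))
  cross-sum = solve-∀
  last-high : ∀ n c → 3 + c + n * 3 ≡ c + suc n * 3
  last-high = solve-∀

weights-ascending : ∀ r c n → weights (ascending r c n) (just (r + n * 3)) ↭
  progression 6 (r + c) n ++ progression 6 (c + (3 + r)) n
weights-ascending r c zero    = ↭-refl
weights-ascending r c (suc n) = begin
  weights (ascending r c (suc n)) (just (r + suc n * 3))
    ↭⟨ weights-ascending-to r c n (r + suc n * 3) ⟩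
  progression 6 (r + c) (suc n) ++ progression 6 (c + (3 + r)) n ++ [ c + n * 3 + (r + suc n * 3) ]
    ≡⟨ cong (λ l → progression 6 (r + c) (suc n) ++ progression 6 (c + (3 + r)) n ++ [ l ]) (last n c r) ⟩
  progression 6 (r + c) (suc n) ++ progression 6 (c + (3 + r)) n ++ [ c + (3 + r) + n * 6 ]
    ≡⟨ cong (progression 6 (r + c) (suc n) ++_) (sym (progression-snoc 6 (c + (3 + r)) n)) ⟩
  progression 6 (r + c) (suc n) ++ progression 6 (c + (3 + r)) (suc n) ∎
  where
  open PermutationReasoning
  last : ∀ n c r → c + n * 3 + (r + suc n * 3) ≡ c + (3 + r) + n * 6
  last = solve-∀

nextLo-descending : ∀ x c n → nextLo (descending (3 + x) c n) (just x) ≡ just (x + n * 3)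
nextLo-descending x c zero    = cong just (sym (ℕP.+-identityʳ x))
nextLo-descending x c (suc n) = begin
  nextLo (descending (3 + (3 + x)) (3 + c) n ++ (3 + x , c) ∷ []) (just x) ≡⟨ nextLo-++ (descending (3 + (3 + x)) (3 + c) n) _ (just x) ⟩
  nextLo (descending (3 + (3 + x)) (3 + c) n) (just (3 + x))               ≡⟨ nextLo-descending (3 + x) (3 + c) n ⟩
  just (3 + x + n * 3)                                                      ≡⟨ cong just (last-low n x) ⟩
  just (x + suc n * 3) ∎
  where
  open ≡-Reasoning
  last-low : ∀ n x → 3 + x + n * 3 ≡ x + suc n * 3
  last-low = solve-∀

weights-descending : ∀ x c n → weights (descending (3 + x) c n) (just x) ↭
  progression 6 ((3 + x) + c) n ++ progression 6 (c + x) n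
weights-descending x c zero    = ↭-refl
weights-descending x c (suc n) = begin
  weights (descending (3 + (3 + x)) (3 + c) n ++ (3 + x , c) ∷ []) (just x)
    ≡⟨ weights-++ (descending (3 + (3 + x)) (3 + c) n) _ (just x) ⟩
  weights (descending (3 + (3 + x)) (3 + c) n) (just (3 + x)) ++ (3 + x) + c ∷ c + x ∷ []
    ↭⟨ ++⁺ʳ _ (weights-descending (3 + x) (3 + c) n) ⟩
  (progression 6 ((3 + (3 + x)) + (3 + c)) n ++ progression 6 ((3 + c) + (3 + x)) n) ++ (3 + x) + c ∷ c + x ∷ []
    ≡⟨ cong₂ (λ a b → (progression 6 a n ++ progression 6 b n) ++ (3 + x) + c ∷ c + x ∷ []) (rung-sum x c) (cross-sum x c) ⟩
  (progression 6 (6 + ((3 + x) + c)) n ++ progression 6 (6 + (c + x)) n) ++ (3 + x) + c ∷ c + x ∷ []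
    ↭⟨ NS.solve 4 (λ p q a b → (p ⊕ q) ⊕ (a ⊕ b) ⊜ (a ⊕ p) ⊕ (b ⊕ q)) ↭-refl
         (progression 6 (6 + ((3 + x) + c)) n) (progression 6 (6 + (c + x)) n) [ (3 + x) + c ] [ c + x ] ⟩
  progression 6 ((3 + x) + c) (suc n) ++ progression 6 (c + x) (suc n) ∎
  where
  open PermutationReasoning
  open NS using (_⊕_; _⊜_)
  rung-sum : ∀ x c → (3 + (3 + x)) + (3 + c) ≡ 6 + ((3 + x) + c)
  rung-sum = solve-∀
  cross-sum : ∀ x c → (3 + c) + (3 + x) ≡ 6 + (c + x)
  cross-sum = solve-∀

data Shape : ℕ → Set where
  ≡0mod4 : ∀ m → Shape (4 + m * 4)
  ≡2mod4 : ∀ m → Shape (6 + m * 4)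

rungs : ∀ {ℓ} → Shape ℓ → ℕ
rungs (≡0mod4 m) = m
rungs (≡2mod4 m) = m

size : ∀ {ℓ} → Shape ℓ → ℕ
size s = 4 + rungs s * 3

grow : ∀ {ℓ} → Shape ℓ → Shape (4 + ℓ)
grow (≡0mod4 m) = ≡0mod4 (suc m)
grow (≡2mod4 m) = ≡2mod4 (suc m)

shape : ∀ j → Shape (4 + j * 2)
shape 0                   = ≡0mod4 0
shape 1                   = ≡2mod4 0
shape (suc (suc j))       = grow (shape j)

shapeOf : ∀ {ℓ} → (2 ∣ ℓ) × (2 < ℓ) → Shape ℓ
shapeOf (divides 0 refl , ())
shapeOf (divides 1 refl , ℕ.s≤s (ℕ.s≤s ()))
shapeOf (divides (suc (suc j)) refl , _) = shape j

-- Two ladders of m rungs meeting at the middle rung 3m + 3; the cycle closes the core through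
-- the vertices 0, 1, 2, which it shares with the path piece in two different ways.
core : ℕ → Zigzag
core m = ascending 3 4 m ++ (3 + m * 3 , 3 + m * 3) ∷ descending 5 3 m

cycleOf : ∀ {ℓ} → Shape ℓ → Zigzag
cycleOf (≡0mod4 m) = core m ++ (2 , 1) ∷ []
cycleOf (≡2mod4 m) = (0 , 1) ∷ core m ++ (2 , 0) ∷ []

pathOf : ∀ {ℓ} → Shape ℓ → Zigzag
pathOf (≡0mod4 m) = (1 , 0) ∷ (0 , 2) ∷ ascending 4 5 m
pathOf (≡2mod4 m) = ascending 1 2 (suc m)

nextLo-core : ∀ m z e → nextLo (core m ++ z) e ≡ just 3
nextLo-core zero    z e = refl
nextLo-core (suc m) z e = refl

length-core : ∀ m → length (core m) ≡ m + suc m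
length-core m = trans (ListP.length-++ (ascending 3 4 m)) (cong₂ (λ a d → a + suc d) (ascending-length 3 4 m) (descending-length 5 3 m))
  where
  ascending-length : ∀ r c n → length (ascending r c n) ≡ n
  ascending-length r c zero    = refl
  ascending-length r c (suc n) = cong suc (ascending-length (3 + r) (3 + c) n)
  descending-length : ∀ r c n → length (descending r c n) ≡ n
  descending-length r c zero    = refl
  descending-length r c (suc n) =
    trans (ListP.length-++ (descending (3 + r) (3 + c) n)) (trans (cong (_+ 1) (descending-length (3 + r) (3 + c) n)) (ℕP.+-comm n 1))

length-cycleOf : ∀ {ℓ} (s : Shape ℓ) → length (closed (cycleOf s)) ≡ ℓ
length-cycleOf (≡0mod4 m) = begin
  length (closed (core m ++ (2 , 1) ∷ []))                      ≡⟨ length-closed (core m ++ (2 , 1) ∷ []) ⟩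
  length (core m ++ (2 , 1) ∷ []) + length (core m ++ (2 , 1) ∷ []) ≡⟨ cong (λ k → k + k) (trans (ListP.length-++ (core m)) (cong (_+ 1) (length-core m))) ⟩
  (m + suc m + 1) + (m + suc m + 1)                              ≡⟨ count m ⟩
  4 + m * 4 ∎
  where
  open ≡-Reasoning
  count : ∀ m → (m + suc m + 1) + (m + suc m + 1) ≡ 4 + m * 4
  count = solve-∀
length-cycleOf (≡2mod4 m) = begin
  length (closed ((0 , 1) ∷ core m ++ (2 , 0) ∷ []))  ≡⟨ length-closed ((0 , 1) ∷ core m ++ (2 , 0) ∷ []) ⟩
  suc k + suc k                                        ≡⟨ cong (λ k → suc k + suc k) (trans (ListP.length-++ (core m)) (cong (_+ 1) (length-core m))) ⟩
  suc (m + suc m + 1) + suc (m + suc m + 1)            ≡⟨ count m ⟩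
  6 + m * 4 ∎
  where
  open ≡-Reasoning
  k : ℕ
  k = length (core m ++ (2 , 0) ∷ [])
  count : ∀ m → suc (m + suc m + 1) + suc (m + suc m + 1) ≡ 6 + m * 4
  count = solve-∀

lows-core : ∀ m → lows (closed (core m)) ↭ progression 3 3 m ++ 3 + m * 3 ∷ progression 3 5 m
lows-core m = begin
  lows (closed (core m))
    ≡⟨ lows-closed-++ (ascending 3 4 m) _ ⟩
  lows (closed (ascending 3 4 m)) ++ 3 + m * 3 ∷ lows (closed (descending 5 3 m))
    ↭⟨ ++⁺ (↭-reflexive (lows-ascending 3 4 m)) (prep _ (lows-descending 5 3 m)) ⟩
  progression 3 3 m ++ 3 + m * 3 ∷ progression 3 5 m ∎
  where open PermutationReasoning

highs-core : ∀ m → highs (closed (core m)) ↭ progression 3 4 m ++ 3 + m * 3 ∷ progression 3 3 m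
highs-core m = begin
  highs (closed (core m))
    ≡⟨ highs-closed-++ (ascending 3 4 m) _ ⟩
  highs (closed (ascending 3 4 m)) ++ 3 + m * 3 ∷ highs (closed (descending 5 3 m))
    ↭⟨ ++⁺ (↭-reflexive (highs-ascending 3 4 m)) (prep _ (highs-descending 5 3 m)) ⟩
  progression 3 4 m ++ 3 + m * 3 ∷ progression 3 3 m ∎
  where open PermutationReasoning

three-progressions-range : ∀ m → 0 ∷ 1 ∷ 2 ∷ (progression 3 3 m ++ progression 3 4 m ++ progression 3 5 m ++ []) ++ [ 3 + m * 3 ]
                   ↭ range 0 (4 + m * 3)
three-progressions-range m = prep 0 (prep 1 (prep 2 (begin
  concatMap (λ a → progression 3 a m) (range 3 3) ++ [ 3 + m * 3 ] ↭⟨ ++⁺ʳ _ (interleave-progressions 3 m 3) ⟩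
  range 3 (m * 3) ++ range (3 + m * 3) 1                            ≡⟨ range-++ 3 (m * 3) 1 ⟩
  range 3 (m * 3 + 1)                                               ≡⟨ cong (range 3) (ℕP.+-comm (m * 3) 1) ⟩
  range 3 (1 + m * 3) ∎)))
  where open PermutationReasoning

block-lows-≡2mod4 : ∀ m → lows (closed (cycleOf (≡2mod4 m)) ++ closed (pathOf (≡2mod4 m))) ↭ range 0 (4 + m * 3)
block-lows-≡2mod4 m = begin
  lows ((lo 0 ∷ hi 1 ∷ closed (core m ++ (2 , 0) ∷ [])) ++ lo 1 ∷ hi 2 ∷ closed (ascending 4 5 m))
    ≡⟨ cong (0 ∷_) (lows-++ (closed (core m ++ (2 , 0) ∷ [])) _) ⟩
  0 ∷ lows (closed (core m ++ (2 , 0) ∷ [])) ++ 1 ∷ lows (closed (ascending 4 5 m))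
    ≡⟨ cong₂ (λ xs ys → 0 ∷ xs ++ 1 ∷ ys) (lows-closed-++ (core m) _) (lows-ascending 4 5 m) ⟩
  0 ∷ (lows (closed (core m)) ++ [ 2 ]) ++ 1 ∷ P 4
    ↭⟨ prep 0 (++⁺ʳ _ (++⁺ʳ _ (lows-core m))) ⟩
  0 ∷ ((P 3 ++ 3 + m * 3 ∷ P 5) ++ [ 2 ]) ++ 1 ∷ P 4
    ↭⟨ prep 0 (NS.solve 6 (λ p₃ p₄ p₅ t l₁ l₂ → ((p₃ ⊕ (t ⊕ p₅)) ⊕ l₂) ⊕ (l₁ ⊕ p₄) ⊜ l₁ ⊕ (l₂ ⊕ ((p₃ ⊕ (p₄ ⊕ (p₅ ⊕ NS.id))) ⊕ t)))
         ↭-refl (P 3) (P 4) (P 5) [ 3 + m * 3 ] [ 1 ] [ 2 ]) ⟩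
  0 ∷ 1 ∷ 2 ∷ (P 3 ++ P 4 ++ P 5 ++ []) ++ [ 3 + m * 3 ]
    ↭⟨ three-progressions-range m ⟩
  range 0 (4 + m * 3) ∎
  where
  open PermutationReasoning
  open NS using (_⊕_; _⊜_)
  P : ℕ → List ℕ
  P a = progression 3 a m

block-highs-≡2mod4 : ∀ m → highs (closed (cycleOf (≡2mod4 m)) ++ closed (pathOf (≡2mod4 m))) ↭ range 0 (4 + m * 3)
block-highs-≡2mod4 m = begin
  highs ((lo 0 ∷ hi 1 ∷ closed (core m ++ (2 , 0) ∷ [])) ++ lo 1 ∷ hi 2 ∷ closed (ascending 4 5 m))
    ≡⟨ cong (1 ∷_) (highs-++ (closed (core m ++ (2 , 0) ∷ [])) _) ⟩
  1 ∷ highs (closed (core m ++ (2 , 0) ∷ [])) ++ 2 ∷ highs (closed (ascending 4 5 m))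
    ≡⟨ cong₂ (λ xs ys → 1 ∷ xs ++ 2 ∷ ys) (highs-closed-++ (core m) _) (highs-ascending 4 5 m) ⟩
  1 ∷ (highs (closed (core m)) ++ [ 0 ]) ++ 2 ∷ P 5
    ↭⟨ prep 1 (++⁺ʳ _ (++⁺ʳ _ (highs-core m))) ⟩
  1 ∷ ((P 4 ++ 3 + m * 3 ∷ P 3) ++ [ 0 ]) ++ 2 ∷ P 5
    ↭⟨ NS.solve 7 (λ p₃ p₄ p₅ t h₀ h₁ h₂ → h₁ ⊕ (((p₄ ⊕ (t ⊕ p₃)) ⊕ h₀) ⊕ (h₂ ⊕ p₅)) ⊜ h₀ ⊕ (h₁ ⊕ (h₂ ⊕ ((p₃ ⊕ (p₄ ⊕ (p₅ ⊕ NS.id))) ⊕ t))))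
         ↭-refl (P 3) (P 4) (P 5) [ 3 + m * 3 ] [ 0 ] [ 1 ] [ 2 ] ⟩
  0 ∷ 1 ∷ 2 ∷ (P 3 ++ P 4 ++ P 5 ++ []) ++ [ 3 + m * 3 ]
    ↭⟨ three-progressions-range m ⟩
  range 0 (4 + m * 3) ∎
  where
  open PermutationReasoning
  open NS using (_⊕_; _⊜_)
  P : ℕ → List ℕ
  P a = progression 3 a m

block-vertices-≡0mod4↭≡2mod4 : ∀ m →
  closed (cycleOf (≡0mod4 m)) ++ closed (pathOf (≡0mod4 m)) ↭ closed (cycleOf (≡2mod4 m)) ++ closed (pathOf (≡2mod4 m))
block-vertices-≡0mod4↭≡2mod4 m = begin
  closed (core m ++ (2 , 1) ∷ []) ++ lo 1 ∷ hi 0 ∷ lo 0 ∷ hi 2 ∷ A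
    ≡⟨ cong (_++ lo 1 ∷ hi 0 ∷ lo 0 ∷ hi 2 ∷ A) (walk-++ (core m) _ nothing) ⟩
  (C ++ lo 2 ∷ hi 1 ∷ []) ++ lo 1 ∷ hi 0 ∷ lo 0 ∷ hi 2 ∷ A
    ↭⟨ VS.solve 8 (λ c a l₀ l₁ l₂ h₀ h₁ h₂ →
           (c ⊕ (l₂ ⊕ (h₁ ⊕ VS.id))) ⊕ (l₁ ⊕ (h₀ ⊕ (l₀ ⊕ (h₂ ⊕ a))))
         ⊜ (l₀ ⊕ (h₁ ⊕ (c ⊕ (l₂ ⊕ (h₀ ⊕ VS.id))))) ⊕ (l₁ ⊕ (h₂ ⊕ a)))
         ↭-refl C A [ lo 0 ] [ lo 1 ] [ lo 2 ] [ hi 0 ] [ hi 1 ] [ hi 2 ] ⟩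
  (lo 0 ∷ hi 1 ∷ C ++ lo 2 ∷ hi 0 ∷ []) ++ lo 1 ∷ hi 2 ∷ A
    ≡⟨ cong (λ vs → (lo 0 ∷ hi 1 ∷ vs) ++ lo 1 ∷ hi 2 ∷ A) (sym (walk-++ (core m) _ nothing)) ⟩
  (lo 0 ∷ hi 1 ∷ closed (core m ++ (2 , 0) ∷ [])) ++ lo 1 ∷ hi 2 ∷ A ∎
  where
  open PermutationReasoning
  open VS using (_⊕_; _⊜_)
  C A : List Vertex
  C = closed (core m)
  A = closed (ascending 4 5 m)

block-vertices : ∀ {ℓ} (s : Shape ℓ) → closed (cycleOf s) ++ closed (pathOf s) ↭ span 0 (size s) (size s)
block-vertices (≡2mod4 m) = span-by-sides 0 (4 + m * 3) (4 + m * 3) (block-lows-≡2mod4 m) (block-highs-≡2mod4 m)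
block-vertices (≡0mod4 m) = ↭-trans (block-vertices-≡0mod4↭≡2mod4 m) (block-vertices (≡2mod4 m))

weights-core : ∀ m → weights (core m) (just 2) ↭
  (progression 6 7 m ++ progression 6 10 m) ++ 6 + m * 6 ∷ 5 + m * 6 ∷ progression 6 8 m ++ progression 6 5 m
weights-core m = begin
  weights (ascending 3 4 m ++ (t , t) ∷ descending 5 3 m) (just 2)
    ≡⟨ weights-++ (ascending 3 4 m) _ (just 2) ⟩
  weights (ascending 3 4 m) (just t) ++ t + t ∷ map (t +_) (fromMaybe (nextLo (descending 5 3 m) (just 2))) ++ weights (descending 5 3 m) (just 2)
    ≡⟨ cong (λ x → weights (ascending 3 4 m) (just t) ++ t + t ∷ map (t +_) (fromMaybe x) ++ weights (descending 5 3 m) (just 2))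
            (nextLo-descending 2 3 m) ⟩
  weights (ascending 3 4 m) (just t) ++ t + t ∷ t + (2 + m * 3) ∷ weights (descending 5 3 m) (just 2)
    ↭⟨ ++⁺ (weights-ascending 3 4 m) (↭-trans (↭-reflexive (cong₂ (λ a b → a ∷ b ∷ weights (descending 5 3 m) (just 2)) (double m) (double-minus-one m)))
                                              (prep _ (prep _ (weights-descending 2 3 m)))) ⟩
  (progression 6 7 m ++ progression 6 10 m) ++ 6 + m * 6 ∷ 5 + m * 6 ∷ progression 6 8 m ++ progression 6 5 m ∎
  where
  open PermutationReasoning
  t : ℕ
  t = 3 + m * 3
  double : ∀ m → (3 + m * 3) + (3 + m * 3) ≡ 6 + m * 6
  double = solve-∀
  double-minus-one : ∀ m → (3 + m * 3) + (2 + m * 3) ≡ 5 + m * 6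
  double-minus-one = solve-∀

cycleWeights-≡2mod4 : ∀ m → cycleWeights (cycleOf (≡2mod4 m)) ≡ 1 ∷ 4 ∷ weights (core m) (just 2) ++ 2 ∷ 0 ∷ []
cycleWeights-≡2mod4 m = cong₂ (λ x ws → 1 ∷ map (1 +_) (fromMaybe x) ++ ws)
  (nextLo-core m _ (just 0)) (weights-++ (core m) _ (just 0))

cycleWeights-≡0mod4 : ∀ m → cycleWeights (cycleOf (≡0mod4 m)) ≡ weights (core m) (just 2) ++ 3 ∷ 4 ∷ []
cycleWeights-≡0mod4 m = trans (cong (weights (core m ++ (2 , 1) ∷ [])) (nextLo-core m _ nothing)) (weights-++ (core m) _ (just 3))

six-progressions-range : ∀ m → 0 ∷ 1 ∷ 2 ∷ 3 ∷ 4 ∷ concatMap (λ a → progression 6 a m) (range 5 6) ++ 5 + m * 6 ∷ 6 + m * 6 ∷ 7 + m * 6 ∷ []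
                    ↭ range 0 ((4 + m * 3) + (4 + m * 3))
six-progressions-range m = begin
  0 ∷ 1 ∷ 2 ∷ 3 ∷ 4 ∷ concatMap (λ a → progression 6 a m) (range 5 6) ++ range (5 + m * 6) 3
    ↭⟨ prep 0 (prep 1 (prep 2 (prep 3 (prep 4 (++⁺ʳ _ (interleave-progressions 6 m 5)))))) ⟩
  0 ∷ 1 ∷ 2 ∷ 3 ∷ 4 ∷ range 5 (m * 6) ++ range (5 + m * 6) 3
    ≡⟨ cong (λ ns → 0 ∷ 1 ∷ 2 ∷ 3 ∷ 4 ∷ ns) (range-++ 5 (m * 6) 3) ⟩
  range 0 (5 + (m * 6 + 3))
    ≡⟨ cong (range 0) (twice-size m) ⟩
  range 0 ((4 + m * 3) + (4 + m * 3)) ∎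
  where
  open PermutationReasoning
  twice-size : ∀ m → 5 + (m * 6 + 3) ≡ (4 + m * 3) + (4 + m * 3)
  twice-size = solve-∀

block-weights-≡2mod4 : ∀ m →
  cycleWeights (cycleOf (≡2mod4 m)) ++ weights (pathOf (≡2mod4 m)) (just (5 + m * 3)) ↭ range 0 ((4 + m * 3) + (4 + m * 3))
block-weights-≡2mod4 m = begin
  cycleWeights (cycleOf (≡2mod4 m)) ++ weights (ascending 1 2 (suc m)) (just (5 + m * 3))
    ≡⟨ cong (_++ weights (ascending 1 2 (suc m)) (just (5 + m * 3))) (cycleWeights-≡2mod4 m) ⟩
  (1 ∷ 4 ∷ weights (core m) (just 2) ++ 2 ∷ 0 ∷ []) ++ weights (ascending 1 2 (suc m)) (just (5 + m * 3))
    ↭⟨ ++⁺ (prep 1 (prep 4 (++⁺ʳ _ (weights-core m)))) (weights-ascending-to 1 2 m (5 + m * 3)) ⟩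
  (1 ∷ 4 ∷ ((P 7 ++ P 10) ++ 6 + m * 6 ∷ 5 + m * 6 ∷ P 8 ++ P 5) ++ 2 ∷ 0 ∷ []) ++ (3 ∷ P 9) ++ P 6 ++ [ 2 + m * 3 + (5 + m * 3) ]
    ≡⟨ cong (λ x → (1 ∷ 4 ∷ ((P 7 ++ P 10) ++ 6 + m * 6 ∷ 5 + m * 6 ∷ P 8 ++ P 5) ++ 2 ∷ 0 ∷ []) ++ (3 ∷ P 9) ++ P 6 ++ [ x ])
            (double-plus-one m) ⟩
  (1 ∷ 4 ∷ ((P 7 ++ P 10) ++ 6 + m * 6 ∷ 5 + m * 6 ∷ P 8 ++ P 5) ++ 2 ∷ 0 ∷ []) ++ (3 ∷ P 9) ++ P 6 ++ [ 7 + m * 6 ]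
    ↭⟨ NS.solve 14 (λ p₅ p₆ p₇ p₈ p₉ p₁₀ w₀ w₁ w₂ w₃ w₄ t₅ t₆ t₇ →
           (w₁ ⊕ (w₄ ⊕ (((p₇ ⊕ p₁₀) ⊕ (t₆ ⊕ (t₅ ⊕ (p₈ ⊕ p₅)))) ⊕ (w₂ ⊕ (w₀ ⊕ NS.id))))) ⊕ ((w₃ ⊕ p₉) ⊕ (p₆ ⊕ t₇))
         ⊜ w₀ ⊕ (w₁ ⊕ (w₂ ⊕ (w₃ ⊕ (w₄ ⊕ ((p₅ ⊕ (p₆ ⊕ (p₇ ⊕ (p₈ ⊕ (p₉ ⊕ (p₁₀ ⊕ NS.id)))))) ⊕ (t₅ ⊕ (t₆ ⊕ (t₇ ⊕ NS.id)))))))))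
         ↭-refl (P 5) (P 6) (P 7) (P 8) (P 9) (P 10) [ 0 ] [ 1 ] [ 2 ] [ 3 ] [ 4 ] [ 5 + m * 6 ] [ 6 + m * 6 ] [ 7 + m * 6 ] ⟩
  0 ∷ 1 ∷ 2 ∷ 3 ∷ 4 ∷ concatMap P (range 5 6) ++ 5 + m * 6 ∷ 6 + m * 6 ∷ 7 + m * 6 ∷ []
    ↭⟨ six-progressions-range m ⟩
  range 0 ((4 + m * 3) + (4 + m * 3)) ∎
  where
  open PermutationReasoning
  open NS using (_⊕_; _⊜_)
  P : ℕ → List ℕ
  P a = progression 6 a m
  double-plus-one : ∀ m → 2 + m * 3 + (5 + m * 3) ≡ 7 + m * 6
  double-plus-one = solve-∀

block-weights-≡0mod4↭≡2mod4 : ∀ m → cycleWeights (cycleOf (≡0mod4 m)) ++ weights (pathOf (≡0mod4 m)) (just (5 + m * 3))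
                                  ↭ cycleWeights (cycleOf (≡2mod4 m)) ++ weights (pathOf (≡2mod4 m)) (just (5 + m * 3))
block-weights-≡0mod4↭≡2mod4 m = begin
  cycleWeights (cycleOf (≡0mod4 m)) ++ 1 ∷ 0 ∷ 2 ∷ T
    ≡⟨ cong (_++ 1 ∷ 0 ∷ 2 ∷ T) (cycleWeights-≡0mod4 m) ⟩
  (W ++ 3 ∷ 4 ∷ []) ++ 1 ∷ 0 ∷ 2 ∷ T
    ↭⟨ NS.solve 7 (λ w t w₀ w₁ w₂ w₃ w₄ → (w ⊕ (w₃ ⊕ (w₄ ⊕ NS.id))) ⊕ (w₁ ⊕ (w₀ ⊕ (w₂ ⊕ t)))
                                        ⊜ (w₁ ⊕ (w₄ ⊕ (w ⊕ (w₂ ⊕ (w₀ ⊕ NS.id))))) ⊕ (w₃ ⊕ t))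
         ↭-refl W T [ 0 ] [ 1 ] [ 2 ] [ 3 ] [ 4 ] ⟩
  (1 ∷ 4 ∷ W ++ 2 ∷ 0 ∷ []) ++ 3 ∷ T
    ≡⟨ cong (_++ 3 ∷ T) (sym (cycleWeights-≡2mod4 m)) ⟩
  cycleWeights (cycleOf (≡2mod4 m)) ++ weights (pathOf (≡2mod4 m)) (just (5 + m * 3)) ∎
  where
  open PermutationReasoning
  open NS using (_⊕_; _⊜_)
  W T : List ℕ
  W = weights (core m) (just 2)
  T = map (2 +_) (fromMaybe (nextLo (ascending 4 5 m) (just (5 + m * 3)))) ++ weights (ascending 4 5 m) (just (5 + m * 3))

block-weights : ∀ {ℓ} (s : Shape ℓ) → cycleWeights (cycleOf s) ++ weights (pathOf s) (just (1 + size s)) ↭ range 0 (size s + size s)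
block-weights (≡2mod4 m) = block-weights-≡2mod4 m
block-weights (≡0mod4 m) = ↭-trans (block-weights-≡0mod4↭≡2mod4 m) (block-weights-≡2mod4 m)

-- Chains of blocks

extent : ∀ {L} → All Shape L → ℕ
extent []       = 0
extent (s ∷ ss) = size s + extent ss

blockCycles : ∀ {L} → ℕ → All Shape L → List Zigzag
blockCycles X []       = []
blockCycles X (s ∷ ss) = translate X (cycleOf s) ∷ blockCycles (X + size s) ss

blockPath : ∀ {L} → ℕ → All Shape L → Zigzag
blockPath X []       = []
blockPath X (s ∷ ss) = translate X (pathOf s) ++ blockPath (X + size s) ss

nextLo-blockPath : ∀ {L} X (ss : All Shape L) → nextLo (blockPath X ss) (just (X + extent ss + 1)) ≡ just (X + 1)
nextLo-blockPath X []                = cong (λ k → just (k + 1)) (ℕP.+-identityʳ X)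
nextLo-blockPath X (≡0mod4 m ∷ ss) = refl
nextLo-blockPath X (≡2mod4 m ∷ ss) = refl

blocks-vertices : ∀ {L} X (ss : All Shape L) →
  concatMap closed (blockCycles X ss) ++ closed (blockPath X ss) ↭ span X (extent ss) (extent ss)
blocks-vertices X []       = ↭-refl
blocks-vertices X (s ∷ ss) = begin
  (C ++ Cs) ++ closed (translate X (pathOf s) ++ restPath) ≡⟨ cong ((C ++ Cs) ++_) (walk-++ (translate X (pathOf s)) restPath nothing) ⟩
  (C ++ Cs) ++ (P ++ Ps)                                   ↭⟨ ++-interchange C Cs P Ps ⟩
  (C ++ P) ++ (Cs ++ Ps)
    ≡⟨ cong (_++ (Cs ++ Ps)) (trans (cong₂ _++_ (walk-translate X (cycleOf s) nothing) (walk-translate X (pathOf s) nothing))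
                                    (sym (ListP.map-++ (translateᵛ X) (closed (cycleOf s)) _))) ⟩
  map (translateᵛ X) (closed (cycleOf s) ++ closed (pathOf s)) ++ (Cs ++ Ps)
    ↭⟨ ++⁺ (map⁺ (translateᵛ X) (block-vertices s)) (blocks-vertices (X + size s) ss) ⟩
  map (translateᵛ X) (span 0 (size s) (size s)) ++ S
    ≡⟨ cong (_++ S) (span-translate X (size s) (size s)) ⟩
  span X (size s) (size s) ++ S
    ↭⟨ span-++ X (size s) (extent ss) (extent ss) ⟩
  span X (extent (s ∷ ss)) (extent (s ∷ ss)) ∎
  where
  open PermutationReasoning
  restPath : Zigzag
  restPath = blockPath (X + size s) ss
  C Cs P Ps S : List Vertex
  C = closed (translate X (cycleOf s))
  Cs = concatMap closed (blockCycles (X + size s) ss)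
  P = closed (translate X (pathOf s))
  Ps = closed restPath
  S = span (X + size s) (extent ss) (extent ss)

blocks-weights : ∀ {L} X (ss : All Shape L) →
  concatMap cycleWeights (blockCycles X ss) ++ weights (blockPath X ss) (just (X + extent ss + 1))
    ↭ range (X + X) (extent ss + extent ss)
blocks-weights X []       = ↭-refl
blocks-weights X (s ∷ ss) = begin
  (C ++ Cs) ++ weights (translate X (pathOf s) ++ restPath) (just (X + e + 1))
    ≡⟨ cong (λ k → (C ++ Cs) ++ weights (translate X (pathOf s) ++ restPath) (just k)) (end-reassoc X (size s) (extent ss)) ⟩
  (C ++ Cs) ++ weights (translate X (pathOf s) ++ restPath) (just X′)
    ≡⟨ cong ((C ++ Cs) ++_) (weights-++ (translate X (pathOf s)) restPath (just X′)) ⟩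
  (C ++ Cs) ++ (weights (translate X (pathOf s)) (nextLo restPath (just X′)) ++ Ps)
    ≡⟨ cong (λ x → (C ++ Cs) ++ (weights (translate X (pathOf s)) x ++ Ps))
            (trans (nextLo-blockPath (X + size s) ss) (cong just (next-offset X (size s)))) ⟩
  (C ++ Cs) ++ (P ++ Ps)
    ↭⟨ ++-interchange C Cs P Ps ⟩
  (C ++ P) ++ (Cs ++ Ps)
    ≡⟨ cong (_++ (Cs ++ Ps)) (trans (cong₂ _++_ (cycleWeights-translate X (cycleOf s)) (weights-translate X (pathOf s) (just (1 + size s))))
                                    (sym (ListP.map-++ (X + X +_) (cycleWeights (cycleOf s)) _))) ⟩
  map (X + X +_) (cycleWeights (cycleOf s) ++ weights (pathOf s) (just (1 + size s))) ++ (Cs ++ Ps)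
    ↭⟨ ++⁺ (map⁺ (X + X +_) (block-weights s)) (blocks-weights (X + size s) ss) ⟩
  map (X + X +_) (range 0 (size s + size s)) ++ range ((X + size s) + (X + size s)) (extent ss + extent ss)
    ≡⟨ cong₂ _++_ (map-+-range₀ (X + X) (size s + size s))
                  (cong (λ a → range a (extent ss + extent ss)) (+-interchange′ X (size s))) ⟩
  range (X + X) (size s + size s) ++ range ((X + X) + (size s + size s)) (extent ss + extent ss)
    ≡⟨ trans (range-++ (X + X) (size s + size s) _) (cong (range (X + X)) (sum-reassoc (size s) (extent ss))) ⟩
  range (X + X) (e + e) ∎
  where
  open PermutationReasoning
  rest : List Zigzag
  rest = blockCycles (X + size s) ss
  restPath : Zigzag
  restPath = blockPath (X + size s) ss
  e X′ : ℕ
  e = extent (s ∷ ss)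
  X′ = X + size s + extent ss + 1
  C Cs P Ps : List ℕ
  C = cycleWeights (translate X (cycleOf s))
  Cs = concatMap cycleWeights rest
  P = weights (translate X (pathOf s)) (just (X + (1 + size s)))
  Ps = weights restPath (just X′)
  end-reassoc : ∀ X a b → X + (a + b) + 1 ≡ X + a + b + 1
  end-reassoc = solve-∀
  next-offset : ∀ X a → X + a + 1 ≡ X + (1 + a)
  next-offset = solve-∀
  +-interchange′ : ∀ X a → (X + a) + (X + a) ≡ (X + X) + (a + a)
  +-interchange′ = solve-∀
  sum-reassoc : ∀ a b → (a + a) + (b + b) ≡ (a + b) + (a + b)
  sum-reassoc = solve-∀

cycle-lengths : ∀ {L} N X (ss : All Shape L) →
  Pointwise (λ ℓ c → length c ≡ ℓ) L (map (λ c → map (label N) (closed c)) (blockCycles X ss))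
cycle-lengths N X []       = []
cycle-lengths {ℓ ∷ _} N X (s ∷ ss) = length-cycle ∷ cycle-lengths N (X + size s) ss
  where
  length-cycle : length (map (label N) (closed (translate X (cycleOf s)))) ≡ ℓ
  length-cycle = begin
    length (map (label N) (closed (translate X (cycleOf s)))) ≡⟨ ListP.length-map (label N) (closed (translate X (cycleOf s))) ⟩
    length (closed (translate X (cycleOf s)))                 ≡⟨ cong length (walk-translate X (cycleOf s) nothing) ⟩
    length (map (translateᵛ X) (closed (cycleOf s)))          ≡⟨ ListP.length-map (translateᵛ X) (closed (cycleOf s)) ⟩
    length (closed (cycleOf s))                               ≡⟨ length-cycleOf s ⟩
    ℓ ∎
    where open ≡-Reasoning

length-concat : ∀ {L} {cs : List (List ℤ)} → Pointwise (λ ℓ c → length c ≡ ℓ) L cs → length (concat cs) ≡ sumL L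
length-concat []                     = refl
length-concat {cs = c ∷ _} (ℓ≡ ∷ ps) = trans (ListP.length-++ c) (cong₂ _+_ ℓ≡ (length-concat ps))

-- Tails

record Tail (n : ℕ) : Set where
  field
    zigzag        : Zigzag
    end           : Maybe ℕ
    lowCount      : ℕ
    highCount     : ℕ
    count         : lowCount + highCount ≡ suc n
    walk↭span     : walk zigzag end ↭ span 0 lowCount highCount
    weights↭range : weights zigzag end ↭ range 0 n
    starts-at-1   : nextLo zigzag end ≡ just 1

square : Zigzag
square = (1 , 1) ∷ (0 , 0) ∷ []

prepend-square : ∀ {n} → Tail n → Tail (4 + n)
prepend-square {n} T = record
  { zigzag        = square ++ translate 2 zigzag
  ; end           = Maybe.map (2 +_) end
  ; lowCount      = 2 + lowCount
  ; highCount     = 2 + highCount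
  ; count         = trans (regroup lowCount highCount) (cong (4 +_) count)
  ; walk↭span     = begin
      walk (square ++ translate 2 zigzag) (Maybe.map (2 +_) end)
        ≡⟨ walk-++ square (translate 2 zigzag) _ ⟩
      closed square ++ walk (translate 2 zigzag) (Maybe.map (2 +_) end)
        ≡⟨ cong (closed square ++_) (walk-translate 2 zigzag end) ⟩
      closed square ++ map (translateᵛ 2) (walk zigzag end)
        ↭⟨ ++⁺ square-span (map⁺ (translateᵛ 2) walk↭span) ⟩
      span 0 2 2 ++ map (translateᵛ 2) (span 0 lowCount highCount)
        ≡⟨ cong (span 0 2 2 ++_) (span-translate 2 lowCount highCount) ⟩
      span 0 2 2 ++ span 2 lowCount highCount
        ↭⟨ span-++ 0 2 lowCount highCount ⟩
      span 0 (2 + lowCount) (2 + highCount) ∎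
  ; weights↭range = begin
      weights (square ++ translate 2 zigzag) (Maybe.map (2 +_) end)
        ≡⟨ weights-++ square (translate 2 zigzag) _ ⟩
      weights square (nextLo (translate 2 zigzag) (Maybe.map (2 +_) end)) ++ weights (translate 2 zigzag) (Maybe.map (2 +_) end)
        ≡⟨ cong₂ (λ x ws → weights square x ++ ws)
                 (trans (nextLo-translate 2 zigzag end) (cong (Maybe.map (2 +_)) starts-at-1))
                 (weights-translate 2 zigzag end) ⟩
      weights square (just 3) ++ map (4 +_) (weights zigzag end)
        ↭⟨ ++⁺ square-weights (map⁺ (4 +_) weights↭range) ⟩
      range 0 4 ++ map (4 +_) (range 0 n)
        ≡⟨ cong (range 0 4 ++_) (map-+-range₀ 4 n) ⟩
      range 0 (4 + n) ∎
  ; starts-at-1   = refl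
  }
  where
  open Tail T
  open PermutationReasoning
  regroup : ∀ a b → 2 + a + (2 + b) ≡ 4 + (a + b)
  regroup = solve-∀
  square-span : closed square ↭ span 0 2 2
  square-span = span-by-sides 0 2 2 (↭-by-sorting refl) (↭-by-sorting refl)
  square-weights : weights square (just 3) ↭ range 0 4
  square-weights = ↭-by-sorting refl

decided-tail : ∀ {n} (z : Zigzag) e a b → a + b ≡ suc n →
  sort (lows (walk z e)) ≡ sort (range 0 a) → sort (highs (walk z e)) ≡ sort (range 0 b) →
  sort (weights z e) ≡ sort (range 0 n) → nextLo z e ≡ just 1 → Tail n
decided-tail z e a b count lows-sorted highs-sorted weights-sorted starts = record
  { zigzag = z ; end = e ; lowCount = a ; highCount = b ; count = count
  ; walk↭span = span-by-sides 0 a b (↭-by-sorting lows-sorted) (↭-by-sorting highs-sorted)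
  ; weights↭range = ↭-by-sorting weights-sorted
  ; starts-at-1 = starts
  }

-- Prepending squares to the end pieces with 5, 2, 3 and 8 edges reaches every n ≥ 5.
tail : ∀ j → Tail (5 + j)
tail 0                         = decided-tail ((1 , 2) ∷ (2 , 0) ∷ (0 , 1) ∷ []) nothing 3 3 refl refl refl refl refl
tail 1                         = prepend-square (decided-tail ((1 , 0) ∷ []) (just 0) 2 1 refl refl refl refl refl)
tail 2                         = prepend-square (decided-tail square nothing 2 2 refl refl refl refl refl)
tail 3                         = decided-tail ((1 , 2) ∷ (2 , 0) ∷ (0 , 1) ∷ (4 , 3) ∷ []) (just 3) 5 4 refl refl refl refl refl
tail (suc (suc (suc (suc j)))) = prepend-square (tail j)

-- The labeling

-- Vertices 0 start the path and vertices 1 carry the 2-cycle; the blocks occupy [2, X) and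
-- the tail, translated by X, takes the rest.
module Construction {L : List ℕ} (ss : All Shape L) {n : ℕ} (T : Tail n) where
  open Tail T

  X ε N M : ℕ
  X = 2 + extent ss
  ε = X + X + n
  N = X + lowCount
  M = X + highCount

  cycleZigzags : List Zigzag
  cycleZigzags = blockCycles 2 ss

  pathZigzag : Zigzag
  pathZigzag = (0 , 0) ∷ blockPath 2 ss ++ translate X zigzag

  pathEnd : Maybe ℕ
  pathEnd = Maybe.map (X +_) end

  allVertices : List Vertex
  allVertices = concatMap closed cycleZigzags ++ lo 1 ∷ hi 1 ∷ walk pathZigzag pathEnd

  allVertices↭span : allVertices ↭ span 0 N M
  allVertices↭span = begin
    CV ++ lo 1 ∷ hi 1 ∷ lo 0 ∷ hi 0 ∷ walk (blockPath 2 ss ++ translate X zigzag) pathEnd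
      ≡⟨ cong (λ vs → CV ++ lo 1 ∷ hi 1 ∷ lo 0 ∷ hi 0 ∷ vs)
              (trans (walk-++ (blockPath 2 ss) _ pathEnd) (cong (BV ++_) (walk-translate X zigzag end))) ⟩
    CV ++ lo 1 ∷ hi 1 ∷ lo 0 ∷ hi 0 ∷ BV ++ TV
      ↭⟨ VS.solve 7 (λ cv bv tv l₀ l₁ h₀ h₁ → cv ⊕ (l₁ ⊕ (h₁ ⊕ (l₀ ⊕ (h₀ ⊕ (bv ⊕ tv)))))
                                            ⊜ (l₀ ⊕ (l₁ ⊕ (h₀ ⊕ (h₁ ⊕ VS.id)))) ⊕ ((cv ⊕ bv) ⊕ tv))
           ↭-refl CV BV TV [ lo 0 ] [ lo 1 ] [ hi 0 ] [ hi 1 ] ⟩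
    span 0 2 2 ++ (CV ++ BV) ++ TV
      ↭⟨ ++⁺ˡ (span 0 2 2) (++⁺ (blocks-vertices 2 ss) (map⁺ (translateᵛ X) walk↭span)) ⟩
    span 0 2 2 ++ span 2 (extent ss) (extent ss) ++ map (translateᵛ X) (span 0 lowCount highCount)
      ≡⟨ cong (λ vs → span 0 2 2 ++ span 2 (extent ss) (extent ss) ++ vs) (span-translate X lowCount highCount) ⟩
    span 0 2 2 ++ span 2 (extent ss) (extent ss) ++ span X lowCount highCount
      ≡⟨ sym (ListP.++-assoc (span 0 2 2) (span 2 (extent ss) (extent ss)) (span X lowCount highCount)) ⟩
    (span 0 2 2 ++ span 2 (extent ss) (extent ss)) ++ span X lowCount highCount
      ↭⟨ ++⁺ʳ _ (span-++ 0 2 (extent ss) (extent ss)) ⟩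
    span 0 X X ++ span X lowCount highCount
      ↭⟨ span-++ 0 X lowCount highCount ⟩
    span 0 N M ∎
    where
    open PermutationReasoning
    open VS using (_⊕_; _⊜_)
    CV BV TV : List Vertex
    CV = concatMap closed cycleZigzags
    BV = closed (blockPath 2 ss)
    TV = map (translateᵛ X) (walk zigzag end)

  blockWeights tailWeights : List ℕ
  blockWeights = weights (blockPath 2 ss) (just (X + 1))
  tailWeights  = map (X + X +_) (weights zigzag end)

  pathWeights : weights pathZigzag pathEnd ≡ 0 ∷ 3 ∷ blockWeights ++ tailWeights
  pathWeights = cong₂ (λ x ws → 0 ∷ map (0 +_) (fromMaybe x) ++ ws)
    (trans (nextLo-++ (blockPath 2 ss) _ pathEnd) (trans (cong (nextLo (blockPath 2 ss)) tail-start) (nextLo-blockPath 2 ss)))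
    (trans (weights-++ (blockPath 2 ss) _ pathEnd)
           (cong₂ _++_ (cong (weights (blockPath 2 ss)) tail-start) (weights-translate X zigzag end)))
    where
    tail-start : nextLo (translate X zigzag) pathEnd ≡ just (X + 1)
    tail-start = trans (nextLo-translate X zigzag end) (cong (Maybe.map (X +_)) starts-at-1)

  allWeights↭ : concatMap cycleWeights cycleZigzags ++ (2 ∷ 2 ∷ []) ++ weights pathZigzag pathEnd
                ↭ 0 ∷ 2 ∷ 2 ∷ range 3 (ε ∸ 3)
  allWeights↭ = begin
    CW ++ (2 ∷ 2 ∷ []) ++ weights pathZigzag pathEnd
      ≡⟨ cong (λ ws → CW ++ (2 ∷ 2 ∷ []) ++ ws) pathWeights ⟩
    CW ++ 2 ∷ 2 ∷ 0 ∷ 3 ∷ blockWeights ++ tailWeights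
      ↭⟨ NS.solve 6 (λ cw bw tw w₀ w₂ w₃ → cw ⊕ (w₂ ⊕ (w₂ ⊕ (w₀ ⊕ (w₃ ⊕ (bw ⊕ tw))))) ⊜ w₀ ⊕ (w₂ ⊕ (w₂ ⊕ (w₃ ⊕ ((cw ⊕ bw) ⊕ tw)))))
           ↭-refl CW blockWeights tailWeights [ 0 ] [ 2 ] [ 3 ] ⟩
    0 ∷ 2 ∷ 2 ∷ 3 ∷ (CW ++ blockWeights) ++ tailWeights
      ↭⟨ prep 0 (prep 2 (prep 2 (prep 3 (++⁺ (blocks-weights 2 ss) (map⁺ (X + X +_) weights↭range))))) ⟩
    0 ∷ 2 ∷ 2 ∷ 3 ∷ range 4 (e + e) ++ map (X + X +_) (range 0 n)
      ≡⟨ cong (λ ns → 0 ∷ 2 ∷ 2 ∷ 3 ∷ range 4 (e + e) ++ ns) (trans (map-+-range₀ (X + X) n) (cong (λ a → range a n) (offset e))) ⟩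
    0 ∷ 2 ∷ 2 ∷ 3 ∷ range 4 (e + e) ++ range (4 + (e + e)) n
      ≡⟨ cong (λ ns → 0 ∷ 2 ∷ 2 ∷ 3 ∷ ns) (range-++ 4 (e + e) n) ⟩
    0 ∷ 2 ∷ 2 ∷ range 3 (suc (e + e + n))
      ≡⟨ cong (λ k → 0 ∷ 2 ∷ 2 ∷ range 3 k) (sym (trans (cong (_∸ 3) (total e n)) (ℕP.m+n∸m≡n 3 _))) ⟩
    0 ∷ 2 ∷ 2 ∷ range 3 (ε ∸ 3) ∎
    where
    open PermutationReasoning
    open NS using (_⊕_; _⊜_)
    CW : List ℕ
    CW = concatMap cycleWeights cycleZigzags
    e : ℕ
    e = extent ss
    offset : ∀ e → (2 + e) + (2 + e) ≡ 4 + (e + e)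
    offset = solve-∀
    total : ∀ e n → (2 + e) + (2 + e) + n ≡ 3 + suc (e + e + n)
    total = solve-∀

  cyclesℤ : List (List ℤ)
  cyclesℤ = map (λ c → map (label N) (closed c)) cycleZigzags

  pathℤ : List ℤ
  pathℤ = map (label N) (walk pathZigzag pathEnd)

  allLabels : concat cyclesℤ ++ label N (lo 1) ∷ label N (hi 1) ∷ pathℤ ≡ map (label N) allVertices
  allLabels = begin
    concat (map (λ c → map (label N) (closed c)) cycleZigzags) ++ rest
      ≡⟨ cong (λ xss → concat xss ++ rest) (ListP.map-∘ cycleZigzags) ⟩
    concat (map (map (label N)) (map closed cycleZigzags)) ++ rest
      ≡⟨ cong (_++ rest) (ListP.concat-map (map closed cycleZigzags)) ⟩
    map (label N) (concatMap closed cycleZigzags) ++ rest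
      ≡⟨ sym (ListP.map-++ (label N) (concatMap closed cycleZigzags) _) ⟩
    map (label N) allVertices ∎
    where
    open ≡-Reasoning
    rest : List ℤ
    rest = label N (lo 1) ∷ label N (hi 1) ∷ pathℤ

  labels↭I : concat cyclesℤ ++ label N (lo 1) ∷ label N (hi 1) ∷ pathℤ ↭ I 0 ε
  labels↭I = begin
    concat cyclesℤ ++ label N (lo 1) ∷ label N (hi 1) ∷ pathℤ ≡⟨ allLabels ⟩
    map (label N) allVertices                                  ↭⟨ map⁺ (label N) allVertices↭span ⟩
    map (label N) (span 0 N M)                                 ↭⟨ labels-span N M ⟩
    ints (range 0 (N + M))                                     ≡⟨ cong (λ k → ints (range 0 k)) vertex-count ⟩
    ints (range 0 (suc ε))                                     ≡⟨ sym (I≡ints-range 0 ε) ⟩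
    I 0 ε ∎
    where
    open PermutationReasoning
    regroup : ∀ X a b → (X + a) + (X + b) ≡ X + X + (a + b)
    regroup = solve-∀
    vertex-count : N + M ≡ suc ε
    vertex-count = trans (regroup X lowCount highCount) (trans (cong (X + X +_) count) (ℕP.+-suc (X + X) n))

  pathEdges : ℕ
  pathEdges = suc (length (map (label N) (walk (blockPath 2 ss ++ translate X zigzag) pathEnd)))

  ε-split : ε ≡ sumL L + 2 + pathEdges
  ε-split = ℕP.suc-injective (begin
    suc ε                                                               ≡⟨ sym (length-range 0 (suc ε)) ⟩
    length (range 0 (suc ε))                                            ≡⟨ sym (ListP.length-map _ (range 0 (suc ε))) ⟩
    length (ints (range 0 (suc ε)))                                     ≡⟨ cong length (sym (I≡ints-range 0 ε)) ⟩
    length (I 0 ε)                                                      ≡⟨ sym (↭-length labels↭I) ⟩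
    length (concat cyclesℤ ++ label N (lo 1) ∷ label N (hi 1) ∷ pathℤ)  ≡⟨ ListP.length-++ (concat cyclesℤ) ⟩
    length (concat cyclesℤ) + (2 + length pathℤ)                        ≡⟨ cong (_+ (2 + length pathℤ)) (length-concat (cycle-lengths N 2 ss)) ⟩
    sumL L + (2 + suc pathEdges)                                        ≡⟨ ℕP.+-suc (sumL L) (2 + pathEdges) ⟩
    suc (sumL L + (2 + pathEdges))                                      ≡⟨ cong suc (sym (ℕP.+-assoc (sumL L) 2 pathEdges)) ⟩
    suc (sumL L + 2 + pathEdges) ∎)
    where open ≡-Reasoning

  pathEdges≡ : ε ∸ sumL L ∸ 2 ≡ pathEdges
  pathEdges≡ = trans (ℕP.∸-+-assoc ε (sumL L) 2)
                     (trans (cong (_∸ (sumL L + 2)) ε-split) (ℕP.m+n∸m≡n (sumL L + 2) pathEdges))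

  Γ : Labeling L (ε ∸ sumL L ∸ 2)
  Γ = record
    { cycles   = cyclesℤ
    ; cycLen   = cycle-lengths N 2 ss
    ; twoA     = label N (lo 1)
    ; twoB     = label N (hi 1)
    ; path     = pathℤ
    ; pathLen  = cong suc (sym pathEdges≡)
    ; distinct = Unique-resp-↭ (↭-sym labels↭I) (Unique-I 0 ε)
    }

  edges≡ε : edges L (ε ∸ sumL L ∸ 2) ≡ ε
  edges≡ε = trans (cong (sumL L + 2 +_) pathEdges≡) (sym ε-split)

  Δ↭ : Δ Γ ↭ pm (ℤ.+ 1 ∷ ℤ.+ 3 ∷ ℤ.+ 3 ∷ []) ++ pm (I 4 ε)
  Δ↭ = begin
    concatMap cycleDiffs cyclesℤ ++ (A ℤ.- B) ∷ (B ℤ.- A) ∷ (A ℤ.- B) ∷ (B ℤ.- A) ∷ [] ++ pathDiffs pathℤ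
      ↭⟨ ++⁺ (cycles-differences N cycleZigzags) (++⁺ two-cycle (walk-differences N pathZigzag pathEnd)) ⟩
    ±suc CW ++ ±suc (2 ∷ 2 ∷ []) ++ ±suc (weights pathZigzag pathEnd)
      ≡⟨ sym (trans (±suc-++ CW _) (cong (±suc CW ++_) (±suc-++ (2 ∷ 2 ∷ []) _))) ⟩
    ±suc (CW ++ (2 ∷ 2 ∷ []) ++ weights pathZigzag pathEnd)
      ↭⟨ ±suc⁺ allWeights↭ ⟩
    ±suc (0 ∷ 2 ∷ 2 ∷ range 3 (ε ∸ 3))
      ↭⟨ ±suc-↭-pm (0 ∷ 2 ∷ 2 ∷ range 3 (ε ∸ 3)) ⟩
    pm (ints (map suc (0 ∷ 2 ∷ 2 ∷ range 3 (ε ∸ 3))))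
      ≡⟨ cong (λ ns → pm (ℤ.+ 1 ∷ ℤ.+ 3 ∷ ℤ.+ 3 ∷ ints ns)) (map-+-range 1 3 (ε ∸ 3)) ⟩
    pm ((ℤ.+ 1 ∷ ℤ.+ 3 ∷ ℤ.+ 3 ∷ []) ++ ints (range 4 (ε ∸ 3)))
      ↭⟨ pm-++ (ℤ.+ 1 ∷ ℤ.+ 3 ∷ ℤ.+ 3 ∷ []) _ ⟩
    pm (ℤ.+ 1 ∷ ℤ.+ 3 ∷ ℤ.+ 3 ∷ []) ++ pm (ints (range 4 (ε ∸ 3)))
      ≡⟨ cong (λ xs → pm (ℤ.+ 1 ∷ ℤ.+ 3 ∷ ℤ.+ 3 ∷ []) ++ pm xs) (sym (I≡ints-range 4 ε)) ⟩
    pm (ℤ.+ 1 ∷ ℤ.+ 3 ∷ ℤ.+ 3 ∷ []) ++ pm (I 4 ε) ∎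
    where
    open PermutationReasoning
    A B : ℤ
    A = label N (lo 1)
    B = label N (hi 1)
    CW : List ℕ
    CW = concatMap cycleWeights cycleZigzags
    two-cycle : (A ℤ.- B) ∷ (B ℤ.- A) ∷ (A ℤ.- B) ∷ (B ℤ.- A) ∷ [] ↭ ±suc (2 ∷ 2 ∷ [])
    two-cycle = ↭-trans (↭-reflexive (cong₂ (λ x y → x ∷ y ∷ x ∷ y ∷ []) (lo-hi-difference N 1 1) (hi-lo-difference N 1 1)))
                        (swap _ _ (swap _ _ ↭-refl))

  graceful : Graceful Γ
  graceful = subst (λ E → (vertices Γ ↭ I 0 E) × (Δ Γ ↭ pm (ℤ.+ 1 ∷ ℤ.+ 3 ∷ ℤ.+ 3 ∷ []) ++ pm (I 4 E)))
                   (sym edges≡ε) (labels↭I , Δ↭)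

  Δp-⊇ : ∀ c → X + X ≤ c ⊎ (X + X ≡ 4 × c ≡ 3) → c ≤ ε → Δp Γ ⊇ₘ I (c + 1) ε
  Δp-⊇ c condition c≤ε with suffix-after-3 (X + X) n c condition c≤ε
  ... | R , suffix = map ℤ.-_ (ints (range (suc c) (ε ∸ c))) ++ ±suc (R ++ 0 ∷ blockWeights) , (begin
    pathDiffs pathℤ
      ↭⟨ walk-differences N pathZigzag pathEnd ⟩
    ±suc (weights pathZigzag pathEnd)
      ≡⟨ cong ±suc pathWeights ⟩
    ±suc (0 ∷ 3 ∷ blockWeights ++ tailWeights)
      ↭⟨ ±suc⁺ (NS.solve 4 (λ bw tw w₀ w₃ → w₀ ⊕ (w₃ ⊕ (bw ⊕ tw)) ⊜ (w₃ ⊕ tw) ⊕ (w₀ ⊕ bw)) ↭-refl blockWeights tailWeights [ 0 ] [ 3 ]) ⟩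
    ±suc ((3 ∷ tailWeights) ++ 0 ∷ blockWeights)
      ↭⟨ ±suc⁺ (++⁺ʳ _ (prep 3 (map⁺ (X + X +_) weights↭range))) ⟩
    ±suc ((3 ∷ map (X + X +_) (range 0 n)) ++ 0 ∷ blockWeights)
      ≡⟨ cong (λ ns → ±suc ((3 ∷ ns) ++ 0 ∷ blockWeights)) (map-+-range₀ (X + X) n) ⟩
    ±suc ((3 ∷ range (X + X) n) ++ 0 ∷ blockWeights)
      ↭⟨ ±suc⁺ (++⁺ʳ _ suffix) ⟩
    ±suc ((range c (ε ∸ c) ++ R) ++ 0 ∷ blockWeights)
      ≡⟨ trans (cong ±suc (ListP.++-assoc (range c (ε ∸ c)) R _)) (±suc-++ (range c (ε ∸ c)) _) ⟩
    ±suc (range c (ε ∸ c)) ++ ±suc (R ++ 0 ∷ blockWeights)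
      ↭⟨ ++⁺ʳ _ (±suc-↭-pm (range c (ε ∸ c))) ⟩
    pm (ints (map suc (range c (ε ∸ c)))) ++ ±suc (R ++ 0 ∷ blockWeights)
      ≡⟨ cong (λ ns → pm (ints ns) ++ ±suc (R ++ 0 ∷ blockWeights)) (map-+-range 1 c (ε ∸ c)) ⟩
    pm (ints (range (suc c) (ε ∸ c))) ++ ±suc (R ++ 0 ∷ blockWeights)
      ≡⟨ ListP.++-assoc (ints (range (suc c) (ε ∸ c))) _ _ ⟩
    ints (range (suc c) (ε ∸ c)) ++ map ℤ.-_ (ints (range (suc c) (ε ∸ c))) ++ ±suc (R ++ 0 ∷ blockWeights)
      ≡⟨ cong (_++ map ℤ.-_ (ints (range (suc c) (ε ∸ c))) ++ ±suc (R ++ 0 ∷ blockWeights)) (sym I-from) ⟩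
    I (c + 1) ε ++ map ℤ.-_ (ints (range (suc c) (ε ∸ c))) ++ ±suc (R ++ 0 ∷ blockWeights) ∎)
    where
    open PermutationReasoning
    open NS using (_⊕_; _⊜_)
    I-from : I (c + 1) ε ≡ ints (range (suc c) (ε ∸ c))
    I-from = trans (I≡ints-range (c + 1) ε) (cong (λ a → ints (range a (suc ε ∸ a))) (ℕP.+-comm c 1))

-- The bound

size≤ : ∀ {ℓ} (s : Shape ℓ) → size s ≤ ℓ
size≤ (≡0mod4 m) = ℕP.+-monoʳ-≤ 4 (ℕP.*-monoʳ-≤ m (ℕP.n≤1+n 3))
size≤ (≡2mod4 m) = ℕP.≤-trans (size≤ (≡0mod4 m)) (ℕP.m≤n+m (4 + m * 4) 2)

extent≤ : ∀ {L} (ss : All Shape L) → extent ss ≤ length L * maxL L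
extent≤ {L} ss = ℕP.≤-trans (extent≤sumL ss) (sumL≤ L)
  where
  extent≤sumL : ∀ {L} (ss : All Shape L) → extent ss ≤ sumL L
  extent≤sumL []       = ℕ.z≤n
  extent≤sumL (s ∷ ss) = ℕP.+-mono-≤ (size≤ s) (extent≤sumL ss)
  sumL≤ : ∀ L → sumL L ≤ length L * maxL L
  sumL≤ []      = ℕ.z≤n
  sumL≤ (ℓ ∷ L) = ℕP.+-mono-≤ (ℕP.m≤m⊔n ℓ (maxL L)) (ℕP.≤-trans (sumL≤ L) (ℕP.*-monoʳ-≤ (length L) (ℕP.m≤n⊔m ℓ (maxL L))))

room-for-tail : ∀ k x e → e ≤ k * x → 2 + e + (2 + e) + 5 ≤ (2 * k + 3) * (x + 3)
room-for-tail k x e e≤ = begin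
  2 + e + (2 + e) + 5    ≡⟨ collect e ⟩
  2 * e + 9              ≤⟨ ℕP.+-monoˡ-≤ 9 (ℕP.*-monoʳ-≤ 2 e≤) ⟩
  2 * (k * x) + 9        ≤⟨ ℕP.m≤m+n _ (6 * k + 3 * x) ⟩
  2 * (k * x) + 9 + (6 * k + 3 * x) ≡⟨ expand k x ⟩
  (2 * k + 3) * (x + 3) ∎
  where
  open ℕP.≤-Reasoning
  collect : ∀ e → 2 + e + (2 + e) + 5 ≡ 2 * e + 9
  collect = solve-∀
  expand : ∀ k x → 2 * (k * x) + 9 + (6 * k + 3 * x) ≡ (2 * k + 3) * (x + 3)
  expand = solve-∀

tail-offset-bound : ∀ k x e → e ≤ suc k * x → 2 + e + (2 + e) ≤ (2 * suc k + 1) * (x + 3)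
tail-offset-bound k x e e≤ = begin
  2 + e + (2 + e)          ≡⟨ collect e ⟩
  2 * e + 4                ≤⟨ ℕP.+-monoˡ-≤ 4 (ℕP.*-monoʳ-≤ 2 e≤) ⟩
  2 * (suc k * x) + 4      ≤⟨ ℕP.m≤m+n _ (6 * k + x + 5) ⟩
  2 * (suc k * x) + 4 + (6 * k + x + 5) ≡⟨ expand k x ⟩
  (2 * suc k + 1) * (x + 3) ∎
  where
  open ℕP.≤-Reasoning
  collect : ∀ e → 2 + e + (2 + e) ≡ 2 * e + 4
  collect = solve-∀
  expand : ∀ k x → 2 * (suc k * x) + 4 + (6 * k + x + 5) ≡ (2 * suc k + 1) * (x + 3)
  expand = solve-∀

-- Without cycles the bound 3 lies below the tail, but then the path edge hi 0 — lo 3 has weight 3.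
tail-position : ∀ {L} (ss : All Shape L) →
  let X = 2 + extent ss in X + X ≤ (2 * length L + 1) * (maxL L + 3) ⊎ (X + X ≡ 4 × (2 * length L + 1) * (maxL L + 3) ≡ 3)
tail-position []                 = inj₂ (refl , refl)
tail-position {ℓ ∷ L} ss@(_ ∷ _) = inj₁ (tail-offset-bound (length L) (maxL (ℓ ∷ L)) (extent ss) (extent≤ ss))

theorem5p2 : (L : List ℕ) → All (λ ℓ → (2 ∣ ℓ) × (2 < ℓ)) L → (ε : ℕ) →
    (2 * length L + 3) * (maxL L + 3) ≤ ε →
    Σ (Labeling L (ε ∸ sumL L ∸ 2)) λ Γ →
      Graceful Γ × (Δp Γ ⊇ₘ I ((2 * length L + 1) * (maxL L + 3) + 1) ε)
theorem5p2 L even ε bound = subst Goal ε′≡ε (Γ , graceful , Δp-⊇ c₀ (tail-position ss) c₀≤ε′)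
  where
  ss : All Shape L
  ss = All.map shapeOf even
  X c₀ : ℕ
  X = 2 + extent ss
  c₀ = (2 * length L + 1) * (maxL L + 3)
  room : X + X + 5 ≤ ε
  room = ℕP.≤-trans (room-for-tail (length L) (maxL L) (extent ss) (extent≤ ss)) bound
  open Construction ss (tail (ε ∸ (X + X + 5))) using (Γ; graceful; Δp-⊇) renaming (ε to ε′)
  ε′≡ε : ε′ ≡ ε
  ε′≡ε = trans (sym (ℕP.+-assoc (X + X) 5 _)) (ℕP.m+[n∸m]≡n room)
  c₀≤ε′ : c₀ ≤ ε′
  c₀≤ε′ = subst (c₀ ≤_) (sym ε′≡ε)
    (ℕP.≤-trans (ℕP.*-monoˡ-≤ (maxL L + 3) (ℕP.+-monoʳ-≤ (2 * length L) (ℕP.m≤n+m 1 2))) bound)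
  Goal : ℕ → Set
  Goal ε = Σ (Labeling L (ε ∸ sumL L ∸ 2)) λ Γ → Graceful Γ × (Δp Γ ⊇ₘ I (c₀ + 1) ε)
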